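{- Let $p\ge 5$ be a prime and let $r$ be an integer with $1\le r\le p-1$ that is a quadratic non-residue modulo $p$. Then for all integers $n\ge 0$ and all integers $k\ge j\ge 0$, \[ a_{p(k-j)+(p-1),\;pk+(p-2)}(pn+r)\equiv 0 \pmod p. \]
   Context: For positive integers $r,s$, $a_{r,s}(n)$ denotes the number of multicolored partitions of $n$ in which each even part may appear in one of $r$ colors and each odd part may appear in one of $s$ colors (copies of the same part size in different colors are distinct), with $a_{r,s}(0)=1$. Equivalently, for $|q|<1$, $\sum_{n\ge0}a_{r,s}(n)q^n = f_2^{s-r}/f_1^{s}$, where $f_m=\prod_{i\ge1}(1-q^{mi})$. -}

module Defs where

open import Data.Nat using (ℕ; zero; suc; _+_; _*_; _∸_; _≤ᵇ_; _%_)
open import Data.Nat.Combinatorics using (_C_)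
open import Data.List using (map; upTo)
open import Data.Nat.ListAction using (sum)
open import Data.Bool using (if_then_else_)
open import Data.Nat.Primality using (Prime)
open import Relation.Binary.PropositionalEquality using (_≢_)

colours : ℕ → ℕ → ℕ → ℕ
colours r s m = if m % 2 ≤ᵇ 0 then r else s

multichoose : ℕ → ℕ → ℕ
multichoose c t = (c + t ∸ 1) C t

-- P r s n m = number of (r,s)-multicoloured partitions of n with all parts ≤ m.
-- Recursion on the largest allowed part size m: choose the number t of parts
-- equal to m (t*m ≤ n) and a multiset of t colours for them.
P : ℕ → ℕ → ℕ → ℕ → ℕ
P r s zero zero = 1
P r s (suc n) zero = 0
P r s n (suc m) =
  sum (map (λ t → if t * suc m ≤ᵇ n
                  then multichoose (colours r s (suc m)) t * P r s (n ∸ t * suc m) m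
                  else 0)
           (upTo (suc n)))

a : ℕ → ℕ → ℕ → ℕ
a r s n = P r s n n

QNR : ℕ → ℕ → Set
-- (for 1 ≤ r ≤ p-1: no x with x² ≡ r (mod p), i.e. no x, q with x·x = q·p + r)
QNR p r = ∀ (x q : ℕ) → x * x ≢ q * p + r

{-# OPTIONS --safe #-}
-- Since (1 − x)^(−c) = ∑ₜ multichoose c t · xᵗ, the generating function of a_{r,s} is
-- ∏_d (1 − q^d)^(−c_d) with c_d = r for even d and c_d = s for odd d.  For the given r and s,
-- r + 1 = p(k − j + 1) and s + 2 = p(k + 1), so this product factors as H · G^p, where G has
-- integer coefficients and H = ∏_d (1 − q^d)^(2 if d odd, 1 if d even) = f₁²/f₂.
-- Writing θ = q d/dq, t · [qᵗ] G^p = p · [qᵗ] (G^(p−1) θG), so p divides [qᵗ] G^p unless p ∣ t.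
-- By Gauss's identity f₁²/f₂ = ∑_{m∈ℤ} (−1)^m q^(m²), [q^(pn+r−t)] H vanishes when p ∣ t,
-- since pn + r − t ≡ r is not a square mod p.  Gauss's identity is used in the finite form
-- ∑_{j≤2n} (−1)^j q^((j−n)²) [2n j]_{q²} = (−1)ⁿ (q; q²)ₙ², proved by induction on the top entry.

module Submission where

open import Defs
open import Data.Nat using (ℕ; _+_; _*_; _∸_; _≤_)
open import Data.Nat.Divisibility using (_∣_; divides; _∣?_; _∣0)
open import Data.Nat.Primality using (Prime; euclidsLemma)

open import Algebra.Bundles using (CommutativeRing)
import Algebra.Solver.Ring
open import Algebra.Solver.Ring.AlmostCommutativeRing using (fromCommutativeRing; _-Raw-AlmostCommutative⟶_)
open import Algebra.Structures using (IsCommutativeRing)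
open import Data.Bool using (true; false; if_then_else_; T)
open import Data.Integer as ℤ using (ℤ; +_)
open import Data.Integer.Divisibility.Signed using (∣ᵤ⇒∣; ∣⇒∣ᵤ; ∣m∣n⇒∣m+n; ∣m⇒∣m*n; ∣n⇒∣m*n) renaming (_∣_ to _ℤ∣_)
import Data.Integer.Properties as ℤ
open import Data.Integer.Tactic.RingSolver using (solve-∀)
open import Data.List using (map; applyUpTo; upTo)
open import Data.Maybe using (Maybe; just; nothing)
open import Data.Nat as ℕ using (zero; suc; _<_; z≤n; s≤s; ∣_-_∣; _≤ᵇ_)
open import Data.Nat.Combinatorics using (nCk+nC[k+1]≡[n+1]C[k+1]; k>n⇒nCk≡0) renaming (_C_ to _choose_)
open import Data.Nat.DivMod using (%-congˡ; m*n%n≡0; [m+kn]%n≡m%n)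
open import Data.Nat.ListAction using (sum)
import Data.Nat.Properties as ℕ
open import Data.Nat.Tactic.RingSolver using () renaming (solve-∀ to ℕ-solve-∀)
open import Data.Product using (_×_; _,_)
open import Data.Sum using (inj₁; inj₂)
open import Data.Unit using (tt)
open import Function using (_∘_; id)
open import Level using (0ℓ)
open import Relation.Binary.PropositionalEquality
import Relation.Binary.Reasoning.Setoid as SetoidReasoning
open import Relation.Binary.Structures using (IsEquivalence)
open import Relation.Nullary using (¬_; yes; no; contradiction)

+ℤ-congˡ : ∀ a {x y} → x ≡ y → a ℤ.+ x ≡ a ℤ.+ y
+ℤ-congˡ a = cong (λ x → a ℤ.+ x)

-- Formal power series over ℤ

Series : Set
Series = ℕ → ℤ

infix 4 _≈_
_≈_ : Series → Series → Set
f ≈ g = ∀ n → f n ≡ g n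

infixl 6 _⊕_
infixl 7 _⊛_
infixl 8 _·_

𝟘 : Series
𝟘 _ = + 0

constant : ℤ → Series
constant c zero    = c
constant c (suc _) = + 0

𝟙 : Series
𝟙 = constant (+ 1)

_⊕_ : Series → Series → Series
(f ⊕ g) n = f n ℤ.+ g n

⊝_ : Series → Series
(⊝ f) n = ℤ.- f n

_·_ : ℤ → Series → Series
(c · f) n = c ℤ.* f n

_⊛_ : Series → Series → Series
(f ⊛ g) zero    = f 0 ℤ.* g 0
(f ⊛ g) (suc n) = f 0 ℤ.* g (suc n) ℤ.+ ((f ∘ suc) ⊛ g) n

≈-isEquivalence : IsEquivalence _≈_
≈-isEquivalence = record
  { refl  = λ _ → refl
  ; sym   = λ e n → sym (e n)
  ; trans = λ e e′ n → trans (e n) (e′ n)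
  }

open IsEquivalence ≈-isEquivalence public
  using () renaming (refl to ≈-refl; sym to ≈-sym; trans to ≈-trans; reflexive to ≈-reflexive)

⊕-cong : ∀ {f f′ g g′} → f ≈ f′ → g ≈ g′ → f ⊕ g ≈ f′ ⊕ g′
⊕-cong e e′ n = cong₂ ℤ._+_ (e n) (e′ n)

⊝-cong : ∀ {f f′} → f ≈ f′ → ⊝ f ≈ ⊝ f′
⊝-cong e n = cong ℤ.-_ (e n)

·-cong : ∀ c {f f′} → f ≈ f′ → c · f ≈ c · f′
·-cong c e n = cong (c ℤ.*_) (e n)

⊛-cong : ∀ {f f′ g g′} → f ≈ f′ → g ≈ g′ → f ⊛ g ≈ f′ ⊛ g′
⊛-cong e e′ zero    = cong₂ ℤ._*_ (e 0) (e′ 0)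
⊛-cong e e′ (suc n) = cong₂ ℤ._+_ (cong₂ ℤ._*_ (e 0) (e′ (suc n))) (⊛-cong (e ∘ suc) e′ n)

⊛-congˡ : ∀ f {g g′} → g ≈ g′ → f ⊛ g ≈ f ⊛ g′
⊛-congˡ f = ⊛-cong {f} ≈-refl

⊛-congʳ : ∀ g {f f′} → f ≈ f′ → f ⊛ g ≈ f′ ⊛ g
⊛-congʳ g e = ⊛-cong e (≈-refl {g})

⊛-zeroˡ : ∀ g → 𝟘 ⊛ g ≈ 𝟘
⊛-zeroˡ g zero    = refl
⊛-zeroˡ g (suc n) = trans (cong₂ ℤ._+_ (ℤ.*-zeroˡ (g (suc n))) (⊛-zeroˡ g n)) (ℤ.+-identityˡ (+ 0))

⊛-identityˡ : ∀ g → 𝟙 ⊛ g ≈ g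
⊛-identityˡ g zero    = ℤ.*-identityˡ (g 0)
⊛-identityˡ g (suc n) =
  trans (cong₂ ℤ._+_ (ℤ.*-identityˡ (g (suc n))) (⊛-zeroˡ g n)) (ℤ.+-identityʳ (g (suc n)))

⊛-distribʳ : ∀ f g h → (f ⊕ g) ⊛ h ≈ f ⊛ h ⊕ g ⊛ h
⊛-distribʳ f g h zero    = ℤ.*-distribʳ-+ (h 0) (f 0) (g 0)
⊛-distribʳ f g h (suc n) =
  trans (+ℤ-congˡ ((f 0 ℤ.+ g 0) ℤ.* h (suc n)) (⊛-distribʳ (f ∘ suc) (g ∘ suc) h n))
        (lemma (f 0) (g 0) (h (suc n)) (((f ∘ suc) ⊛ h) n) (((g ∘ suc) ⊛ h) n))
  where
  lemma : ∀ a b c x y → (a ℤ.+ b) ℤ.* c ℤ.+ (x ℤ.+ y) ≡ (a ℤ.* c ℤ.+ x) ℤ.+ (b ℤ.* c ℤ.+ y)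
  lemma = solve-∀

·-⊛ : ∀ c f g → (c · f) ⊛ g ≈ c · (f ⊛ g)
·-⊛ c f g zero    = ℤ.*-assoc c (f 0) (g 0)
·-⊛ c f g (suc n) =
  trans (+ℤ-congˡ (c ℤ.* f 0 ℤ.* g (suc n)) (·-⊛ c (f ∘ suc) g n)) (lemma c (f 0) (g (suc n)) (((f ∘ suc) ⊛ g) n))
  where
  lemma : ∀ c a b x → c ℤ.* a ℤ.* b ℤ.+ c ℤ.* x ≡ c ℤ.* (a ℤ.* b ℤ.+ x)
  lemma = solve-∀

⊛-unfoldʳ : ∀ f g n → (f ⊛ g) (suc n) ≡ f (suc n) ℤ.* g 0 ℤ.+ (f ⊛ (g ∘ suc)) n
⊛-unfoldʳ f g zero    = ℤ.+-comm (f 0 ℤ.* g 1) (f 1 ℤ.* g 0)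
⊛-unfoldʳ f g (suc n) =
  trans (+ℤ-congˡ (f 0 ℤ.* g (suc (suc n))) (⊛-unfoldʳ (f ∘ suc) g n))
        (lemma (f 0 ℤ.* g (suc (suc n))) (f (suc (suc n)) ℤ.* g 0) (((f ∘ suc) ⊛ (g ∘ suc)) n))
  where
  lemma : ∀ a b c → a ℤ.+ (b ℤ.+ c) ≡ b ℤ.+ (a ℤ.+ c)
  lemma = solve-∀

⊛-comm : ∀ f g → f ⊛ g ≈ g ⊛ f
⊛-comm f g zero    = ℤ.*-comm (f 0) (g 0)
⊛-comm f g (suc n) =
  trans (cong₂ ℤ._+_ (ℤ.*-comm (f 0) (g (suc n))) (⊛-comm (f ∘ suc) g n)) (sym (⊛-unfoldʳ g f n))

⊛-assoc : ∀ f g h → (f ⊛ g) ⊛ h ≈ f ⊛ (g ⊛ h)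
⊛-assoc f g h zero    = ℤ.*-assoc (f 0) (g 0) (h 0)
⊛-assoc f g h (suc n) =
  trans (+ℤ-congˡ (f 0 ℤ.* g 0 ℤ.* h (suc n))
          (trans (⊛-distribʳ (f 0 · (g ∘ suc)) ((f ∘ suc) ⊛ g) h n)
                 (cong₂ ℤ._+_ (·-⊛ (f 0) (g ∘ suc) h n) (⊛-assoc (f ∘ suc) g h n))))
        (lemma (f 0) (g 0) (h (suc n)) (((g ∘ suc) ⊛ h) n) (((f ∘ suc) ⊛ (g ⊛ h)) n))
  where
  lemma : ∀ a b c x y → a ℤ.* b ℤ.* c ℤ.+ (a ℤ.* x ℤ.+ y) ≡ a ℤ.* (b ℤ.* c ℤ.+ x) ℤ.+ y
  lemma = solve-∀

⊛-distribˡ : ∀ f g h → f ⊛ (g ⊕ h) ≈ f ⊛ g ⊕ f ⊛ h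
⊛-distribˡ f g h n =
  trans (⊛-comm f (g ⊕ h) n)
        (trans (⊛-distribʳ g h f n) (cong₂ ℤ._+_ (⊛-comm g f n) (⊛-comm h f n)))

⊛-identityʳ : ∀ g → g ⊛ 𝟙 ≈ g
⊛-identityʳ g n = trans (⊛-comm g 𝟙 n) (⊛-identityˡ g n)

⊛-zeroʳ : ∀ g → g ⊛ 𝟘 ≈ 𝟘
⊛-zeroʳ g n = trans (⊛-comm g 𝟘 n) (⊛-zeroˡ g n)

⊕-identityˡ : ∀ f → 𝟘 ⊕ f ≈ f
⊕-identityˡ f n = ℤ.+-identityˡ (f n)

⊕-identityʳ : ∀ f → f ⊕ 𝟘 ≈ f
⊕-identityʳ f n = ℤ.+-identityʳ (f n)

⊕-⊛-isCommutativeRing : IsCommutativeRing _≈_ _⊕_ _⊛_ ⊝_ 𝟘 𝟙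
⊕-⊛-isCommutativeRing = record
  { isRing = record
    { +-isAbelianGroup = record
      { isGroup = record
        { isMonoid = record
          { isSemigroup = record
            { isMagma = record { isEquivalence = ≈-isEquivalence ; ∙-cong = ⊕-cong }
            ; assoc   = λ f g h n → ℤ.+-assoc (f n) (g n) (h n)
            }
          ; identity = ⊕-identityˡ , ⊕-identityʳ
          }
        ; inverse = (λ f n → ℤ.+-inverseˡ (f n)) , (λ f n → ℤ.+-inverseʳ (f n))
        ; ⁻¹-cong = ⊝-cong
        }
      ; comm = λ f g n → ℤ.+-comm (f n) (g n)
      }
    ; *-cong     = ⊛-cong
    ; *-assoc    = ⊛-assoc
    ; *-identity = ⊛-identityˡ , ⊛-identityʳ
    ; distrib    = ⊛-distribˡ , λ f g h → ⊛-distribʳ g h f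
    }
  ; *-comm = ⊛-comm
  }

⊕-⊛-commutativeRing : CommutativeRing 0ℓ 0ℓ
⊕-⊛-commutativeRing = record { isCommutativeRing = ⊕-⊛-isCommutativeRing }

open SetoidReasoning (CommutativeRing.setoid ⊕-⊛-commutativeRing)

constant-morphism :
  CommutativeRing.rawRing ℤ.+-*-commutativeRing
    -Raw-AlmostCommutative⟶ fromCommutativeRing ⊕-⊛-commutativeRing
constant-morphism = record
  { ⟦_⟧    = constant
  ; +-homo = λ { a b zero → refl ; a b (suc n) → refl }
  ; *-homo = λ { a b zero → refl ; a b (suc n) → sym (cong₂ ℤ._+_ (ℤ.*-zeroʳ a) (⊛-zeroˡ (constant b) n)) }
  ; -‿homo = λ { a zero → refl ; a (suc n) → refl }
  ; 0-homo = λ { zero → refl ; (suc n) → refl }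
  ; 1-homo = λ _ → refl
  }

constant-≟ : ∀ a b → Maybe (constant a ≈ constant b)
constant-≟ a b with a ℤ.≟ b
... | yes refl = just ≈-refl
... | no _     = nothing

open Algebra.Solver.Ring _ (fromCommutativeRing ⊕-⊛-commutativeRing) constant-morphism constant-≟
  using (solve; _:=_; _:+_; _:*_; :-_; _:-_; con)

shift : ℕ → Series → Series
shift zero    f n       = f n
shift (suc d) f zero    = + 0
shift (suc d) f (suc n) = shift d f n

q^_ : ℕ → Series
q^ d = shift d 𝟙

1-q^_ : ℕ → Series
1-q^ d = 𝟙 ⊕ ⊝ q^ d

shift-cong : ∀ d {f g} → f ≈ g → shift d f ≈ shift d g
shift-cong zero    e n       = e n
shift-cong (suc d) e zero    = refl
shift-cong (suc d) e (suc n) = shift-cong d e n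

shift-+ : ∀ d f n → shift d f (d + n) ≡ f n
shift-+ zero    f n = refl
shift-+ (suc d) f n = shift-+ d f n

shift-< : ∀ d f {n} → n < d → shift d f n ≡ + 0
shift-< (suc d) f {zero}  _         = refl
shift-< (suc d) f {suc n} (s≤s n<d) = shift-< d f n<d

shift-shift : ∀ a b f → shift (a + b) f ≈ shift a (shift b f)
shift-shift zero    b f n       = refl
shift-shift (suc a) b f zero    = refl
shift-shift (suc a) b f (suc n) = shift-shift a b f n

shift-⊛ : ∀ d f g → shift d f ⊛ g ≈ shift d (f ⊛ g)
shift-⊛ zero    f g n       = refl
shift-⊛ (suc d) f g zero    = ℤ.*-zeroˡ (g 0)
shift-⊛ (suc d) f g (suc n) =
  trans (cong (ℤ._+ (shift d f ⊛ g) n) (ℤ.*-zeroˡ (g (suc n))))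
        (trans (ℤ.+-identityˡ _) (shift-⊛ d f g n))

shift≈q^⊛ : ∀ d f → shift d f ≈ q^ d ⊛ f
shift≈q^⊛ d f = ≈-sym (≈-trans (shift-⊛ d 𝟙 f) (shift-cong d (⊛-identityˡ f)))

q^⊛-+ : ∀ d f n → (q^ d ⊛ f) (d + n) ≡ f n
q^⊛-+ d f n = trans (sym (shift≈q^⊛ d f (d + n))) (shift-+ d f n)

q^⊛-< : ∀ d f {n} → n < d → (q^ d ⊛ f) n ≡ + 0
q^⊛-< d f n<d = trans (sym (shift≈q^⊛ d f _)) (shift-< d f n<d)

q^-+ : ∀ a b → q^ (a + b) ≈ q^ a ⊛ q^ b
q^-+ a b = ≈-trans (shift-shift a b 𝟙) (shift≈q^⊛ a (q^ b))

q^-cancelˡ : ∀ d {f g} → q^ d ⊛ f ≈ q^ d ⊛ g → f ≈ g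
q^-cancelˡ d {f} {g} e n = trans (sym (q^⊛-+ d f n)) (trans (e (d + n)) (q^⊛-+ d g n))

1-q^0≈𝟘 : 1-q^ 0 ≈ 𝟘
1-q^0≈𝟘 zero    = refl
1-q^0≈𝟘 (suc n) = refl

1-q^-+ : ∀ a b → 1-q^ (a + b) ≈ 1-q^ a ⊕ q^ a ⊛ 1-q^ b
1-q^-+ a b = begin
  𝟙 ⊕ ⊝ q^ (a + b)            ≈⟨ ⊕-cong {𝟙} ≈-refl (⊝-cong (q^-+ a b)) ⟩
  𝟙 ⊕ ⊝ (q^ a ⊛ q^ b)         ≈⟨ solve 2 (λ x y → con (+ 1) :- x :* y := (con (+ 1) :- x) :+ x :* (con (+ 1) :- y))
                                         ≈-refl (q^ a) (q^ b) ⟩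
  1-q^ a ⊕ q^ a ⊛ 1-q^ b       ∎

-- Finite products and sums

∏ : (ℕ → Series) → ℕ → Series
∏ g zero    = 𝟙
∏ g (suc m) = g 0 ⊛ ∏ (g ∘ suc) m

pow : Series → ℕ → Series
pow f k = ∏ (λ _ → f) k

∏-cong : ∀ m {g h} → (∀ i → g i ≈ h i) → ∏ g m ≈ ∏ h m
∏-cong zero    e = ≈-refl
∏-cong (suc m) e = ⊛-cong (e 0) (∏-cong m (e ∘ suc))

∏-suc : ∀ g m → ∏ g (suc m) ≈ ∏ g m ⊛ g m
∏-suc g zero    = ⊛-comm (g 0) 𝟙
∏-suc g (suc m) = ≈-trans (⊛-congˡ (g 0) (∏-suc (g ∘ suc) m)) (≈-sym (⊛-assoc (g 0) _ _))

∏-+ : ∀ g a b → ∏ g (a + b) ≈ ∏ g a ⊛ ∏ (λ i → g (a + i)) b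
∏-+ g zero    b = ≈-sym (⊛-identityˡ _)
∏-+ g (suc a) b = ≈-trans (⊛-congˡ (g 0) (∏-+ (g ∘ suc) a b)) (≈-sym (⊛-assoc (g 0) _ _))

∏-offset-suc : ∀ f c j → ∏ (λ i → f (c + i)) (suc j) ≈ f c ⊛ ∏ (λ i → f (suc c + i)) j
∏-offset-suc f c j =
  ⊛-cong (≈-reflexive (cong f (ℕ.+-identityʳ c))) (∏-cong j (λ i → ≈-reflexive (cong f (ℕ.+-suc c i))))

∏-⊛ : ∀ g h m → ∏ (λ i → g i ⊛ h i) m ≈ ∏ g m ⊛ ∏ h m
∏-⊛ g h zero    = ≈-sym (⊛-identityˡ 𝟙)
∏-⊛ g h (suc m) =
  ≈-trans (⊛-congˡ (g 0 ⊛ h 0) (∏-⊛ (g ∘ suc) (h ∘ suc) m))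
          (solve 4 (λ a b c d → (a :* b) :* (c :* d) := (a :* c) :* (b :* d)) ≈-refl
                 (g 0) (h 0) (∏ (g ∘ suc) m) (∏ (h ∘ suc) m))

∏-𝟙 : ∀ m → ∏ (λ _ → 𝟙) m ≈ 𝟙
∏-𝟙 zero    = ≈-refl
∏-𝟙 (suc m) = ≈-trans (⊛-identityˡ _) (∏-𝟙 m)

∏-pow : ∀ g k m → ∏ (λ i → pow (g i) k) m ≈ pow (∏ g m) k
∏-pow g k zero    = ≈-sym (∏-𝟙 k)
∏-pow g k (suc m) =
  ≈-trans (⊛-congˡ (pow (g 0) k) (∏-pow (g ∘ suc) k m))
          (≈-sym (∏-⊛ (λ _ → g 0) (λ _ → ∏ (g ∘ suc) m) k))

∏-pairs : ∀ g m → ∏ g (2 * m) ≈ ∏ (λ l → g (2 * l) ⊛ g (suc (2 * l))) m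
∏-pairs g zero    = ≈-refl
∏-pairs g (suc m) = begin
  ∏ g (2 * suc m)
    ≈⟨ ≈-reflexive (cong (∏ g) (ℕ.*-suc 2 m)) ⟩
  g 0 ⊛ (g 1 ⊛ ∏ (g ∘ suc ∘ suc) (2 * m))
    ≈⟨ ⊛-congˡ (g 0) (⊛-congˡ (g 1) (∏-pairs (g ∘ suc ∘ suc) m)) ⟩
  g 0 ⊛ (g 1 ⊛ ∏ (λ l → g (suc (suc (2 * l))) ⊛ g (suc (suc (suc (2 * l))))) m)
    ≈⟨ ≈-sym (⊛-assoc (g 0) (g 1) _) ⟩
  g 0 ⊛ g 1 ⊛ ∏ (λ l → g (suc (suc (2 * l))) ⊛ g (suc (suc (suc (2 * l))))) m
    ≈⟨ ⊛-congˡ (g 0 ⊛ g 1) (∏-cong m (λ l → ≈-reflexive (cong (λ x → g x ⊛ g (suc x)) (sym (ℕ.*-suc 2 l))))) ⟩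
  ∏ (λ l → g (2 * l) ⊛ g (suc (2 * l))) (suc m) ∎

∑ℤ : (ℕ → ℤ) → ℕ → ℤ
∑ℤ h zero    = + 0
∑ℤ h (suc m) = h 0 ℤ.+ ∑ℤ (h ∘ suc) m

∑ℤ-cong : ∀ m {h h′} → (∀ i → i < m → h i ≡ h′ i) → ∑ℤ h m ≡ ∑ℤ h′ m
∑ℤ-cong zero    e = refl
∑ℤ-cong (suc m) e = cong₂ ℤ._+_ (e 0 (s≤s z≤n)) (∑ℤ-cong m (λ i i<m → e (suc i) (s≤s i<m)))

∑ℤ-zero : ∀ m h → (∀ i → i < m → h i ≡ + 0) → ∑ℤ h m ≡ + 0
∑ℤ-zero zero    h e = refl
∑ℤ-zero (suc m) h e = cong₂ ℤ._+_ (e 0 (s≤s z≤n)) (∑ℤ-zero m (h ∘ suc) (λ i i<m → e (suc i) (s≤s i<m)))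

∑ℤ-+ : ∀ m h h′ → ∑ℤ (λ i → h i ℤ.+ h′ i) m ≡ ∑ℤ h m ℤ.+ ∑ℤ h′ m
∑ℤ-+ zero    h h′ = refl
∑ℤ-+ (suc m) h h′ =
  trans (+ℤ-congˡ (h 0 ℤ.+ h′ 0) (∑ℤ-+ m (h ∘ suc) (h′ ∘ suc)))
        (lemma (h 0) (h′ 0) (∑ℤ (h ∘ suc) m) (∑ℤ (h′ ∘ suc) m))
  where
  lemma : ∀ a b c d → a ℤ.+ b ℤ.+ (c ℤ.+ d) ≡ a ℤ.+ c ℤ.+ (b ℤ.+ d)
  lemma = solve-∀

∑ℤ-*ˡ : ∀ m c h → c ℤ.* ∑ℤ h m ≡ ∑ℤ (λ i → c ℤ.* h i) m
∑ℤ-*ˡ zero    c h = ℤ.*-zeroʳ c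
∑ℤ-*ˡ (suc m) c h =
  trans (ℤ.*-distribˡ-+ c (h 0) (∑ℤ (h ∘ suc) m)) (+ℤ-congˡ (c ℤ.* h 0) (∑ℤ-*ˡ m c (h ∘ suc)))

∑ℤ-neg : ∀ m h → ℤ.- ∑ℤ h m ≡ ∑ℤ (λ i → ℤ.- h i) m
∑ℤ-neg zero    h = refl
∑ℤ-neg (suc m) h = trans (ℤ.neg-distrib-+ (h 0) _) (+ℤ-congˡ (ℤ.- h 0) (∑ℤ-neg m (h ∘ suc)))

∑ℤ-+-length : ∀ a b h → ∑ℤ h (a + b) ≡ ∑ℤ h a ℤ.+ ∑ℤ (λ i → h (a + i)) b
∑ℤ-+-length zero    b h = sym (ℤ.+-identityˡ _)
∑ℤ-+-length (suc a) b h =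
  trans (+ℤ-congˡ (h 0) (∑ℤ-+-length a b (h ∘ suc))) (sym (ℤ.+-assoc (h 0) _ _))

∑ : (ℕ → Series) → ℕ → Series
∑ F m n = ∑ℤ (λ i → F i n) m

∑-cong : ∀ m {F G} → (∀ i → i < m → F i ≈ G i) → ∑ F m ≈ ∑ G m
∑-cong m e n = ∑ℤ-cong m (λ i i<m → e i i<m n)

∑-⊕ : ∀ m F G → ∑ (λ i → F i ⊕ G i) m ≈ ∑ F m ⊕ ∑ G m
∑-⊕ m F G n = ∑ℤ-+ m (λ i → F i n) (λ i → G i n)

∑-⊝ : ∀ m F → ⊝ ∑ F m ≈ ∑ (λ i → ⊝ F i) m
∑-⊝ m F n = ∑ℤ-neg m (λ i → F i n)

∑-suc : ∀ m F → ∑ F (suc m) ≈ ∑ F m ⊕ F m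
∑-suc zero    F n = ℤ.+-comm (F 0 n) (+ 0)
∑-suc (suc m) F n = trans (+ℤ-congˡ (F 0 n) (∑-suc m (F ∘ suc) n)) (sym (ℤ.+-assoc (F 0 n) _ _))

⊛-∑ : ∀ m f F → f ⊛ ∑ F m ≈ ∑ (λ i → f ⊛ F i) m
⊛-∑ zero    f F = ⊛-zeroʳ f
⊛-∑ (suc m) f F = ≈-trans (⊛-distribˡ f (F 0) (∑ (F ∘ suc) m)) (⊕-cong {f ⊛ F 0} ≈-refl (⊛-∑ m f (F ∘ suc)))

⊛-coeff : ∀ f g n → (f ⊛ g) n ≡ ∑ℤ (λ i → f i ℤ.* g (n ∸ i)) (suc n)
⊛-coeff f g zero    = sym (ℤ.+-identityʳ _)
⊛-coeff f g (suc n) = +ℤ-congˡ (f 0 ℤ.* g (suc n)) (⊛-coeff (f ∘ suc) g n)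

infix 4 _≈[<_]_
_≈[<_]_ : Series → ℕ → Series → Set
f ≈[< K ] g = ∀ n → n < K → f n ≡ g n

≈⇒≈[<] : ∀ {K f g} → f ≈ g → f ≈[< K ] g
≈⇒≈[<] e n _ = e n

≈[<]-sym : ∀ {K f g} → f ≈[< K ] g → g ≈[< K ] f
≈[<]-sym e n n<K = sym (e n n<K)

≈[<]-trans : ∀ {K f g h} → f ≈[< K ] g → g ≈[< K ] h → f ≈[< K ] h
≈[<]-trans e e′ n n<K = trans (e n n<K) (e′ n n<K)

≈[<]-weaken : ∀ {K K′ f g} → K′ ≤ K → f ≈[< K ] g → f ≈[< K′ ] g
≈[<]-weaken K′≤K e n n<K′ = e n (ℕ.<-≤-trans n<K′ K′≤K)

⊛-cong-≈[<] : ∀ {K f f′ g g′} → f ≈[< K ] f′ → g ≈[< K ] g′ → f ⊛ g ≈[< K ] f′ ⊛ g′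
⊛-cong-≈[<] {f = f} {f′} {g} {g′} e e′ n n<K =
  trans (⊛-coeff f g n)
        (trans (∑ℤ-cong (suc n) (λ i i≤n → cong₂ ℤ._*_ (e i (ℕ.≤-<-trans (ℕ.≤-pred i≤n) n<K))
                                                       (e′ (n ∸ i) (ℕ.≤-<-trans (ℕ.m∸n≤m n i) n<K))))
               (sym (⊛-coeff f′ g′ n)))

1-q^-≈[<]-𝟙 : ∀ d → 1-q^ d ≈[< d ] 𝟙
1-q^-≈[<]-𝟙 d n n<d = trans (+ℤ-congˡ (𝟙 n) (cong ℤ.-_ (shift-< d 𝟙 n<d))) (ℤ.+-identityʳ (𝟙 n))

∏-≈[<]-𝟙 : ∀ K g m → (∀ i → i < m → g i ≈[< K ] 𝟙) → ∏ g m ≈[< K ] 𝟙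
∏-≈[<]-𝟙 K g zero    e = ≈⇒≈[<] ≈-refl
∏-≈[<]-𝟙 K g (suc m) e =
  ≈[<]-trans (⊛-cong-≈[<] (e 0 (s≤s z≤n)) (∏-≈[<]-𝟙 K (g ∘ suc) m (λ i i<m → e (suc i) (s≤s i<m))))
             (≈⇒≈[<] (⊛-identityˡ 𝟙))

⊛-≈[<]-𝟙 : ∀ {K} f {g} → g ≈[< K ] 𝟙 → f ⊛ g ≈[< K ] f
⊛-≈[<]-𝟙 f e = ≈[<]-trans (⊛-cong-≈[<] (≈⇒≈[<] (≈-refl {f})) e) (≈⇒≈[<] (⊛-identityʳ f))

-- Gauss's identity

square : ℕ → ℕ
square x = x * x

sign : ℕ → Series
sign zero    = 𝟙
sign (suc j) = ⊝ sign j

oddFactor : ℕ → Series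
oddFactor l = 1-q^ (suc (2 * l))

evenFactor : ℕ → Series
evenFactor l = 1-q^ (2 * l)

-- evenRising c j = (q^(2c); q²)ⱼ and oddRising c m = (q^(2c+1); q²)ₘ in q-Pochhammer notation.
evenRising : ℕ → ℕ → Series
evenRising c j = ∏ (λ i → evenFactor (c + i)) j

evenPochhammer : ℕ → Series
evenPochhammer = evenRising 1

oddRising : ℕ → ℕ → Series
oddRising c m = ∏ (λ l → oddFactor (c + l)) m

evenRising-+ : ∀ c a b → evenRising c (a + b) ≈ evenRising c a ⊛ evenRising (c + a) b
evenRising-+ c a b =
  ≈-trans (∏-+ (λ i → evenFactor (c + i)) a b)
          (⊛-congˡ (evenRising c a) (∏-cong b (λ i → ≈-reflexive (cong evenFactor (sym (ℕ.+-assoc c a i))))))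

evenFactor-≈[<]-𝟙 : ∀ {K} e → K ≤ e → evenFactor e ≈[< K ] 𝟙
evenFactor-≈[<]-𝟙 e K≤e = ≈[<]-weaken (ℕ.≤-trans K≤e (ℕ.m≤n*m e 2)) (1-q^-≈[<]-𝟙 (2 * e))

evenRising-≈[<]-𝟙 : ∀ {K} c j → K ≤ c → evenRising c j ≈[< K ] 𝟙
evenRising-≈[<]-𝟙 {K} c j K≤c =
  ∏-≈[<]-𝟙 K _ j (λ i _ → evenFactor-≈[<]-𝟙 (c + i) (ℕ.≤-trans K≤c (ℕ.m≤m+n c i)))

-- Gaussian binomial coefficients in base q².
qBinomial : ℕ → ℕ → Series
qBinomial zero    zero    = 𝟙
qBinomial zero    (suc j) = 𝟘
qBinomial (suc m) zero    = 𝟙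
qBinomial (suc m) (suc j) = qBinomial m (suc j) ⊕ q^ (2 * (m ∸ j)) ⊛ qBinomial m j

qBinomial-zero : ∀ m → qBinomial m 0 ≈ 𝟙
qBinomial-zero zero    = ≈-refl
qBinomial-zero (suc m) = ≈-refl

qBinomial-> : ∀ m j → m < j → qBinomial m j ≈ 𝟘
qBinomial-> zero    (suc j) _         = ≈-refl
qBinomial-> (suc m) (suc j) (s≤s m<j) = begin
  qBinomial m (suc j) ⊕ q^ (2 * (m ∸ j)) ⊛ qBinomial m j
    ≈⟨ ⊕-cong (qBinomial-> m (suc j) (ℕ.m<n⇒m<1+n m<j)) (⊛-congˡ (q^ (2 * (m ∸ j))) (qBinomial-> m j m<j)) ⟩
  𝟘 ⊕ q^ (2 * (m ∸ j)) ⊛ 𝟘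
    ≈⟨ ≈-trans (⊕-identityˡ _) (⊛-zeroʳ _) ⟩
  𝟘 ∎

evenFactor-+ : ∀ a b → evenFactor (a + b) ≈ evenFactor a ⊕ q^ (2 * a) ⊛ evenFactor b
evenFactor-+ a b = ≈-trans (≈-reflexive (cong 1-q^_ (ℕ.*-distribˡ-+ 2 a b))) (1-q^-+ (2 * a) (2 * b))

qBinomial-⊛-evenPochhammer : ∀ m j → j ≤ m → qBinomial m j ⊛ evenPochhammer j ≈ evenRising (suc (m ∸ j)) j
qBinomial-⊛-evenPochhammer zero    zero    _         = ⊛-identityˡ 𝟙
qBinomial-⊛-evenPochhammer (suc m) zero    _         = ⊛-identityˡ 𝟙
qBinomial-⊛-evenPochhammer (suc m) (suc j) (s≤s j≤m) = begin
  (qBinomial m (suc j) ⊕ Qc ⊛ qBinomial m j) ⊛ evenPochhammer (suc j)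
    ≈⟨ ⊛-distribʳ (qBinomial m (suc j)) (Qc ⊛ qBinomial m j) (evenPochhammer (suc j)) ⟩
  qBinomial m (suc j) ⊛ evenPochhammer (suc j) ⊕ Qc ⊛ qBinomial m j ⊛ evenPochhammer (suc j)
    ≈⟨ ⊕-cong upper (⊛-congˡ (Qc ⊛ qBinomial m j) (∏-suc (λ i → evenFactor (suc i)) j)) ⟩
  evenFactor c ⊛ Π ⊕ Qc ⊛ qBinomial m j ⊛ (evenPochhammer j ⊛ evenFactor (suc j))
    ≈⟨ ⊕-cong {evenFactor c ⊛ Π} ≈-refl
         (solve 4 (λ a b v e → a :* b :* (v :* e) := a :* (b :* v) :* e) ≈-refl
                Qc (qBinomial m j) (evenPochhammer j) (evenFactor (suc j))) ⟩
  evenFactor c ⊛ Π ⊕ Qc ⊛ (qBinomial m j ⊛ evenPochhammer j) ⊛ evenFactor (suc j)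
    ≈⟨ ⊕-cong {evenFactor c ⊛ Π} ≈-refl
         (⊛-congʳ (evenFactor (suc j)) (⊛-congˡ Qc (qBinomial-⊛-evenPochhammer m j j≤m))) ⟩
  evenFactor c ⊛ Π ⊕ Qc ⊛ Π ⊛ evenFactor (suc j)
    ≈⟨ solve 4 (λ a p b e → a :* p :+ b :* p :* e := p :* (a :+ b :* e)) ≈-refl
             (evenFactor c) Π Qc (evenFactor (suc j)) ⟩
  Π ⊛ (evenFactor c ⊕ Qc ⊛ evenFactor (suc j))
    ≈⟨ ⊛-congˡ Π (≈-sym (evenFactor-+ c (suc j))) ⟩
  Π ⊛ evenFactor (c + suc j)
    ≈⟨ ⊛-congˡ Π (≈-reflexive (cong evenFactor (ℕ.+-suc c j))) ⟩
  Π ⊛ evenFactor (suc c + j)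
    ≈⟨ ≈-sym (∏-suc (λ i → evenFactor (suc c + i)) j) ⟩
  evenRising (suc c) (suc j) ∎
  where
  c  = m ∸ j
  Qc = q^ (2 * c)
  Π  = evenRising (suc c) j
  upper : qBinomial m (suc j) ⊛ evenPochhammer (suc j) ≈ evenFactor c ⊛ Π
  upper with ℕ.m≤n⇒m<n∨m≡n j≤m
  ... | inj₁ j<m = ≈-trans (qBinomial-⊛-evenPochhammer m (suc j) j<m)
                           (≈-trans (≈-reflexive (cong (λ x → evenRising x (suc j)) (sym (ℕ.+-∸-assoc 1 j<m))))
                                    (∏-offset-suc evenFactor c j))
  ... | inj₂ j≡m = begin
    qBinomial m (suc j) ⊛ evenPochhammer (suc j) ≈⟨ ⊛-congʳ (evenPochhammer (suc j)) (qBinomial-> m (suc j) (s≤s (ℕ.≤-reflexive (sym j≡m)))) ⟩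
    𝟘 ⊛ evenPochhammer (suc j)                   ≈⟨ ⊛-zeroˡ _ ⟩
    𝟘                                             ≈⟨ ≈-sym (⊛-zeroˡ Π) ⟩
    𝟘 ⊛ Π                                         ≈⟨ ⊛-congʳ Π (≈-sym (≈-trans (≈-reflexive (cong evenFactor (ℕ.m≤n⇒m∸n≡0 (ℕ.≤-reflexive (sym j≡m))))) 1-q^0≈𝟘)) ⟩
    evenFactor c ⊛ Π                              ∎

square-∣suc-∣ : ∀ j n → square ∣ suc j - n ∣ + 2 * n ≡ square ∣ j - n ∣ + suc (2 * j)
square-∣suc-∣ zero    zero    = refl
square-∣suc-∣ (suc j) zero    = lemma j
  where
  lemma : ∀ j → suc (suc j) * suc (suc j) + 2 * 0 ≡ suc j * suc j + suc (2 * suc j)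
  lemma = ℕ-solve-∀
square-∣suc-∣ zero    (suc n) = lemma n
  where
  lemma : ∀ n → n * n + 2 * suc n ≡ suc n * suc n + suc (2 * 0)
  lemma = ℕ-solve-∀
square-∣suc-∣ (suc j) (suc n) =
  trans (shuffle₁ (square ∣ suc j - n ∣) n)
        (trans (cong (_+ 2) (square-∣suc-∣ j n)) (shuffle₂ (square ∣ j - n ∣) j))
  where
  shuffle₁ : ∀ x n → x + 2 * suc n ≡ x + 2 * n + 2
  shuffle₁ = ℕ-solve-∀
  shuffle₂ : ∀ y j → y + suc (2 * j) + 2 ≡ y + suc (2 * suc j)
  shuffle₂ = ℕ-solve-∀

gaussExponent : ∀ n m j → j ≤ m →
  square ∣ suc j - n ∣ + 2 * (m ∸ j) + 2 * n ≡ square ∣ j - n ∣ + suc (2 * m)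
gaussExponent n m j j≤m =
  trans (shuffle₁ (square ∣ suc j - n ∣) (m ∸ j) n)
        (trans (cong (_+ 2 * (m ∸ j)) (square-∣suc-∣ j n))
               (trans (shuffle₂ (square ∣ j - n ∣) j (m ∸ j))
                      (cong (λ x → square ∣ j - n ∣ + suc (2 * x)) (ℕ.m+[n∸m]≡n j≤m))))
  where
  shuffle₁ : ∀ x a n → x + 2 * a + 2 * n ≡ x + 2 * n + 2 * a
  shuffle₁ = ℕ-solve-∀
  shuffle₂ : ∀ y j a → y + suc (2 * j) + 2 * a ≡ y + suc (2 * (j + a))
  shuffle₂ = ℕ-solve-∀

-- By Cauchy's q-binomial theorem gaussSum n m = q^(n²) ∏_{i<m} (1 − q^(2i+1−2n)). As the factors
-- with 2i + 1 < 2n have negative exponents, the formula is proved separately for m ≤ n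
-- (gaussSum-≤) and m ≥ n (gaussSum-+), in forms with natural exponents.
gaussTerm : ℕ → ℕ → ℕ → Series
gaussTerm n m j = sign j ⊛ (q^ square ∣ j - n ∣ ⊛ qBinomial m j)

gaussSum : ℕ → ℕ → Series
gaussSum n m = ∑ (gaussTerm n m) (suc m)

gaussTerm′ : ℕ → ℕ → ℕ → Series
gaussTerm′ n m j = sign j ⊛ (q^ (square ∣ suc j - n ∣ + 2 * (m ∸ j)) ⊛ qBinomial m j)

gaussSum′ : ℕ → ℕ → Series
gaussSum′ n m = ∑ (gaussTerm′ n m) (suc m)

gaussTerm-pascal : ∀ n m j → gaussTerm n (suc m) (suc j) ≈ gaussTerm n m (suc j) ⊕ ⊝ gaussTerm′ n m j
gaussTerm-pascal n m j = begin
  ⊝ sign j ⊛ (q^ x ⊛ (qBinomial m (suc j) ⊕ q^ y ⊛ qBinomial m j))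
    ≈⟨ solve 5 (λ s x g₁ y g₀ → (:- s) :* (x :* (g₁ :+ y :* g₀)) := (:- s) :* (x :* g₁) :+ :- (s :* ((x :* y) :* g₀)))
             ≈-refl (sign j) (q^ x) (qBinomial m (suc j)) (q^ y) (qBinomial m j) ⟩
  gaussTerm n m (suc j) ⊕ ⊝ (sign j ⊛ ((q^ x ⊛ q^ y) ⊛ qBinomial m j))
    ≈⟨ ⊕-cong {gaussTerm n m (suc j)} ≈-refl
         (⊝-cong (⊛-congˡ (sign j) (⊛-congʳ (qBinomial m j) (≈-sym (q^-+ x y))))) ⟩
  gaussTerm n m (suc j) ⊕ ⊝ gaussTerm′ n m j ∎
  where
  x = square ∣ suc j - n ∣
  y = 2 * (m ∸ j)

gaussSum-suc : ∀ n m → gaussSum n (suc m) ≈ gaussSum n m ⊕ ⊝ gaussSum′ n m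
gaussSum-suc n m = begin
  gaussTerm n (suc m) 0 ⊕ ∑ (λ j → gaussTerm n (suc m) (suc j)) (suc m)
    ≈⟨ ⊕-cong first (∑-cong (suc m) (λ j _ → gaussTerm-pascal n m j)) ⟩
  gaussTerm n m 0 ⊕ ∑ (λ j → gaussTerm n m (suc j) ⊕ ⊝ gaussTerm′ n m j) (suc m)
    ≈⟨ ⊕-cong {gaussTerm n m 0} ≈-refl
         (≈-trans (∑-⊕ (suc m) (gaussTerm n m ∘ suc) (λ j → ⊝ gaussTerm′ n m j))
                  (⊕-cong {∑ (gaussTerm n m ∘ suc) (suc m)} ≈-refl (≈-sym (∑-⊝ (suc m) (gaussTerm′ n m))))) ⟩
  gaussTerm n m 0 ⊕ (∑ (gaussTerm n m ∘ suc) (suc m) ⊕ ⊝ gaussSum′ n m)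
    ≈⟨ (λ i → sym (ℤ.+-assoc (gaussTerm n m 0 i) _ _)) ⟩
  ∑ (gaussTerm n m) (suc (suc m)) ⊕ ⊝ gaussSum′ n m
    ≈⟨ ⊕-cong (∑-suc (suc m) (gaussTerm n m)) ≈-refl ⟩
  gaussSum n m ⊕ gaussTerm n m (suc m) ⊕ ⊝ gaussSum′ n m
    ≈⟨ ⊕-cong (≈-trans (⊕-cong {gaussSum n m} ≈-refl last) (⊕-identityʳ (gaussSum n m))) ≈-refl ⟩
  gaussSum n m ⊕ ⊝ gaussSum′ n m ∎
  where
  first : gaussTerm n (suc m) 0 ≈ gaussTerm n m 0
  first = ⊛-congˡ 𝟙 (⊛-congˡ (q^ square n) (≈-sym (qBinomial-zero m)))
  last : gaussTerm n m (suc m) ≈ 𝟘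
  last = ≈-trans (⊛-congˡ (sign (suc m)) (≈-trans (⊛-congˡ (q^ square ∣ suc m - n ∣) (qBinomial-> m (suc m) ℕ.≤-refl)) (⊛-zeroʳ _)))
                 (⊛-zeroʳ _)

q^-⊛-gaussSum′ : ∀ n m → q^ (2 * n) ⊛ gaussSum′ n m ≈ q^ (suc (2 * m)) ⊛ gaussSum n m
q^-⊛-gaussSum′ n m = begin
  q^ (2 * n) ⊛ gaussSum′ n m                          ≈⟨ ⊛-∑ (suc m) (q^ (2 * n)) (gaussTerm′ n m) ⟩
  ∑ (λ j → q^ (2 * n) ⊛ gaussTerm′ n m j) (suc m)    ≈⟨ ∑-cong (suc m) (λ j j≤m → term j (ℕ.≤-pred j≤m)) ⟩
  ∑ (λ j → q^ (suc (2 * m)) ⊛ gaussTerm n m j) (suc m) ≈⟨ ≈-sym (⊛-∑ (suc m) (q^ (suc (2 * m))) (gaussTerm n m)) ⟩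
  q^ (suc (2 * m)) ⊛ gaussSum n m                     ∎
  where
  term : ∀ j → j ≤ m → q^ (2 * n) ⊛ gaussTerm′ n m j ≈ q^ (suc (2 * m)) ⊛ gaussTerm n m j
  term j j≤m = begin
    q^ (2 * n) ⊛ (sign j ⊛ (q^ e′ ⊛ qBinomial m j))
      ≈⟨ solve 4 (λ a s b g → a :* (s :* (b :* g)) := s :* ((b :* a) :* g)) ≈-refl
               (q^ (2 * n)) (sign j) (q^ e′) (qBinomial m j) ⟩
    sign j ⊛ ((q^ e′ ⊛ q^ (2 * n)) ⊛ qBinomial m j)
      ≈⟨ ⊛-congˡ (sign j) (⊛-congʳ (qBinomial m j) (≈-sym (q^-+ e′ (2 * n)))) ⟩
    sign j ⊛ (q^ (e′ + 2 * n) ⊛ qBinomial m j)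
      ≈⟨ ⊛-congˡ (sign j) (⊛-congʳ (qBinomial m j) (≈-reflexive (cong q^_ (gaussExponent n m j j≤m)))) ⟩
    sign j ⊛ (q^ (e + suc (2 * m)) ⊛ qBinomial m j)
      ≈⟨ ⊛-congˡ (sign j) (⊛-congʳ (qBinomial m j) (q^-+ e (suc (2 * m)))) ⟩
    sign j ⊛ ((q^ e ⊛ q^ (suc (2 * m))) ⊛ qBinomial m j)
      ≈⟨ solve 4 (λ a s b g → s :* ((b :* a) :* g) := a :* (s :* (b :* g))) ≈-refl
               (q^ (suc (2 * m))) (sign j) (q^ e) (qBinomial m j) ⟩
    q^ (suc (2 * m)) ⊛ gaussTerm n m j ∎
    where
    e′ = square ∣ suc j - n ∣ + 2 * (m ∸ j)
    e  = square ∣ j - n ∣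

gaussSum-≤ : ∀ n m → m ≤ n → gaussSum n m ≈ sign m ⊛ (q^ square (n ∸ m) ⊛ oddRising (n ∸ m) m)
gaussSum-≤ n zero    _   = ⊕-identityʳ (gaussTerm n 0 0)
gaussSum-≤ n (suc m) m<n = q^-cancelˡ (suc (2 * d)) (begin
  C ⊛ gaussSum n (suc m)
    ≈⟨ ⊛-congˡ C (gaussSum-suc n m) ⟩
  C ⊛ (L ⊕ ⊝ L′)
    ≈⟨ solve 3 (λ c x y → c :* (x :- y) := c :* x :- c :* y) ≈-refl C L L′ ⟩
  C ⊛ L ⊕ ⊝ (C ⊛ L′)
    ≈⟨ ⊕-cong {C ⊛ L} ≈-refl (⊝-cong C⊛L′≈L) ⟩
  C ⊛ L ⊕ ⊝ L
    ≈⟨ ⊕-cong (⊛-congˡ C IH) (⊝-cong IH) ⟩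
  C ⊛ (s ⊛ ((A ⊛ C) ⊛ Π)) ⊕ ⊝ (s ⊛ ((A ⊛ C) ⊛ Π))
    ≈⟨ solve 4 (λ c s a p → c :* (s :* ((a :* c) :* p)) :- s :* ((a :* c) :* p)
                          := c :* ((:- s) :* (a :* ((con (+ 1) :- c) :* p)))) ≈-refl C s A Π ⟩
  C ⊛ (⊝ s ⊛ (A ⊛ (oddFactor d ⊛ Π)))
    ≈⟨ ⊛-congˡ C (⊛-congˡ (⊝ s) (⊛-congˡ A (≈-sym (∏-offset-suc oddFactor d m)))) ⟩
  C ⊛ (sign (suc m) ⊛ (A ⊛ oddRising d (suc m))) ∎)
  where
  d  = n ∸ suc m
  C  = q^ (suc (2 * d))
  L  = gaussSum n m
  L′ = gaussSum′ n m
  s  = sign m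
  A  = q^ square d
  Π  = oddRising (suc d) m
  square-suc : ∀ x → suc x * suc x ≡ x * x + suc (2 * x)
  square-suc = ℕ-solve-∀
  IH : L ≈ s ⊛ ((A ⊛ C) ⊛ Π)
  IH = ≈-trans (gaussSum-≤ n m (ℕ.<⇒≤ m<n))
         (≈-trans (≈-reflexive (cong (λ x → s ⊛ (q^ square x ⊛ oddRising x m)) (ℕ.+-∸-assoc 1 m<n)))
                  (⊛-congˡ s (⊛-congʳ Π (≈-trans (≈-reflexive (cong q^_ (square-suc d))) (q^-+ (square d) _)))))
  exponents : suc (2 * m) + suc (2 * d) ≡ 2 * n
  exponents = trans (lemma m d) (cong (2 *_) (ℕ.m+[n∸m]≡n m<n))
    where
    lemma : ∀ x y → suc (2 * x) + suc (2 * y) ≡ 2 * (suc x + y)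
    lemma = ℕ-solve-∀
  C⊛L′≈L : C ⊛ L′ ≈ L
  C⊛L′≈L = q^-cancelˡ (suc (2 * m)) (begin
    q^ (suc (2 * m)) ⊛ (C ⊛ L′)   ≈⟨ ≈-sym (⊛-assoc (q^ (suc (2 * m))) C L′) ⟩
    q^ (suc (2 * m)) ⊛ C ⊛ L′     ≈⟨ ⊛-congʳ L′ (≈-sym (q^-+ (suc (2 * m)) (suc (2 * d)))) ⟩
    q^ (suc (2 * m) + suc (2 * d)) ⊛ L′ ≈⟨ ⊛-congʳ L′ (≈-reflexive (cong q^_ exponents)) ⟩
    q^ (2 * n) ⊛ L′               ≈⟨ q^-⊛-gaussSum′ n m ⟩
    q^ (suc (2 * m)) ⊛ L          ∎)

gaussSum-+ : ∀ n t → gaussSum n (n + t) ≈ sign n ⊛ (oddRising 0 n ⊛ oddRising 0 t)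
gaussSum-+ n zero = begin
  gaussSum n (n + 0)
    ≈⟨ ≈-reflexive (cong (gaussSum n) (ℕ.+-identityʳ n)) ⟩
  gaussSum n n
    ≈⟨ gaussSum-≤ n n ℕ.≤-refl ⟩
  sign n ⊛ (q^ square (n ∸ n) ⊛ oddRising (n ∸ n) n)
    ≈⟨ ≈-reflexive (cong (λ x → sign n ⊛ (q^ square x ⊛ oddRising x n)) (ℕ.n∸n≡0 n)) ⟩
  sign n ⊛ (𝟙 ⊛ oddRising 0 n)
    ≈⟨ ⊛-congˡ (sign n) (⊛-comm 𝟙 (oddRising 0 n)) ⟩
  sign n ⊛ (oddRising 0 n ⊛ 𝟙) ∎
gaussSum-+ n (suc t) = begin
  gaussSum n (n + suc t)
    ≈⟨ ≈-reflexive (cong (gaussSum n) (ℕ.+-suc n t)) ⟩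
  gaussSum n (suc m)
    ≈⟨ gaussSum-suc n m ⟩
  L ⊕ ⊝ gaussSum′ n m
    ≈⟨ ⊕-cong {L} ≈-refl (⊝-cong L′≈C⊛L) ⟩
  L ⊕ ⊝ (C ⊛ L)
    ≈⟨ solve 2 (λ c x → x :- c :* x := (con (+ 1) :- c) :* x) ≈-refl C L ⟩
  oddFactor t ⊛ L
    ≈⟨ ⊛-congˡ (oddFactor t) (gaussSum-+ n t) ⟩
  oddFactor t ⊛ (sign n ⊛ (oddRising 0 n ⊛ oddRising 0 t))
    ≈⟨ solve 4 (λ f s x y → f :* (s :* (x :* y)) := s :* (x :* (y :* f))) ≈-refl
             (oddFactor t) (sign n) (oddRising 0 n) (oddRising 0 t) ⟩
  sign n ⊛ (oddRising 0 n ⊛ (oddRising 0 t ⊛ oddFactor t))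
    ≈⟨ ⊛-congˡ (sign n) (⊛-congˡ (oddRising 0 n) (≈-sym (∏-suc oddFactor t))) ⟩
  sign n ⊛ (oddRising 0 n ⊛ oddRising 0 (suc t)) ∎
  where
  m = n + t
  C = q^ (suc (2 * t))
  L = gaussSum n m
  exponents : suc (2 * m) ≡ 2 * n + suc (2 * t)
  exponents = lemma n t
    where
    lemma : ∀ x y → suc (2 * (x + y)) ≡ 2 * x + suc (2 * y)
    lemma = ℕ-solve-∀
  L′≈C⊛L : gaussSum′ n m ≈ C ⊛ L
  L′≈C⊛L = q^-cancelˡ (2 * n) (begin
    q^ (2 * n) ⊛ gaussSum′ n m       ≈⟨ q^-⊛-gaussSum′ n m ⟩
    q^ (suc (2 * m)) ⊛ L             ≈⟨ ⊛-congʳ L (≈-trans (≈-reflexive (cong q^_ exponents)) (q^-+ (2 * n) _)) ⟩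
    q^ (2 * n) ⊛ C ⊛ L               ≈⟨ ⊛-assoc (q^ (2 * n)) C L ⟩
    q^ (2 * n) ⊛ (C ⊛ L)             ∎)

colours-even : ∀ r s l → colours r s (2 * l) ≡ r
colours-even r s l = cong (λ x → if x ≤ᵇ 0 then r else s) (trans (%-congˡ {o = 2} (ℕ.*-comm 2 l)) (m*n%n≡0 l 2))

colours-odd : ∀ r s l → colours r s (suc (2 * l)) ≡ s
colours-odd r s l =
  cong (λ x → if x ≤ᵇ 0 then r else s) (trans (%-congˡ {o = 2} (cong suc (ℕ.*-comm 2 l))) ([m+kn]%n≡m%n 1 l 2))

-- gaussProduct N truncates f₁²/f₂ to the factors with d ≤ N; the exponent is written as
-- colours 1 2 d so that it matches the factors split off in partitionSeries-decomposition.
gaussFactor : ℕ → Series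
gaussFactor d = pow (1-q^ d) (colours 1 2 d)

gaussProduct : ℕ → Series
gaussProduct N = ∏ (λ i → gaussFactor (suc i)) N

gaussProduct-double : ∀ n → gaussProduct (2 * n) ≈ (oddRising 0 n ⊛ oddRising 0 n) ⊛ evenPochhammer n
gaussProduct-double n = begin
  gaussProduct (2 * n)
    ≈⟨ ∏-pairs (λ i → gaussFactor (suc i)) n ⟩
  ∏ (λ l → gaussFactor (suc (2 * l)) ⊛ gaussFactor (suc (suc (2 * l)))) n
    ≈⟨ ∏-cong n (λ l → ⊛-cong (odd l) (even l)) ⟩
  ∏ (λ l → (oddFactor l ⊛ oddFactor l) ⊛ evenFactor (suc l)) n
    ≈⟨ ∏-⊛ (λ l → oddFactor l ⊛ oddFactor l) (λ l → evenFactor (suc l)) n ⟩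
  ∏ (λ l → oddFactor l ⊛ oddFactor l) n ⊛ evenPochhammer n
    ≈⟨ ⊛-congʳ (evenPochhammer n) (∏-⊛ oddFactor oddFactor n) ⟩
  (oddRising 0 n ⊛ oddRising 0 n) ⊛ evenPochhammer n ∎
  where
  odd : ∀ l → gaussFactor (suc (2 * l)) ≈ oddFactor l ⊛ oddFactor l
  odd l = ≈-trans (≈-reflexive (cong (pow (oddFactor l)) (colours-odd 1 2 l)))
                  (⊛-congˡ (oddFactor l) (⊛-identityʳ (oddFactor l)))
  even : ∀ l → gaussFactor (suc (suc (2 * l))) ≈ evenFactor (suc l)
  even l = ≈-trans (≈-reflexive (cong gaussFactor (sym (ℕ.*-suc 2 l))))
                   (≈-trans (≈-reflexive (cong (pow (evenFactor (suc l))) (colours-even 1 2 (suc l))))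
                            (⊛-identityʳ (evenFactor (suc l))))

sign-⊛-sign : ∀ n → sign n ⊛ sign n ≈ 𝟙
sign-⊛-sign zero    = ⊛-identityˡ 𝟙
sign-⊛-sign (suc n) = ≈-trans (solve 1 (λ s → (:- s) :* (:- s) := s :* s) ≈-refl (sign n)) (sign-⊛-sign n)

gaussRemainder : ℕ → ℕ → Series
gaussRemainder n j = qBinomial (2 * n) j ⊛ evenPochhammer n

gaussProduct-expansion : ∀ n →
  gaussProduct (2 * n) ≈ ∑ (λ j → sign n ⊛ (sign j ⊛ (q^ square ∣ j - n ∣ ⊛ gaussRemainder n j))) (suc (2 * n))
gaussProduct-expansion n = begin
  gaussProduct (2 * n)
    ≈⟨ gaussProduct-double n ⟩
  (O ⊛ O) ⊛ V
    ≈⟨ ≈-sym (⊛-identityˡ ((O ⊛ O) ⊛ V)) ⟩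
  𝟙 ⊛ ((O ⊛ O) ⊛ V)
    ≈⟨ ⊛-congʳ ((O ⊛ O) ⊛ V) (≈-sym (sign-⊛-sign n)) ⟩
  (sign n ⊛ sign n) ⊛ ((O ⊛ O) ⊛ V)
    ≈⟨ solve 3 (λ s o v → (s :* s) :* ((o :* o) :* v) := (v :* s) :* (s :* (o :* o))) ≈-refl (sign n) O V ⟩
  (V ⊛ sign n) ⊛ (sign n ⊛ (O ⊛ O))
    ≈⟨ ⊛-congˡ (V ⊛ sign n) (≈-sym (≈-trans (≈-reflexive (cong (gaussSum n) (sym n+n≡2n))) (gaussSum-+ n n))) ⟩
  (V ⊛ sign n) ⊛ gaussSum n (2 * n)
    ≈⟨ ⊛-∑ (suc (2 * n)) (V ⊛ sign n) (gaussTerm n (2 * n)) ⟩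
  ∑ (λ j → (V ⊛ sign n) ⊛ gaussTerm n (2 * n) j) (suc (2 * n))
    ≈⟨ ∑-cong (suc (2 * n)) (λ j _ → solve 5 (λ v s t x b → (v :* s) :* (t :* (x :* b)) := s :* (t :* (x :* (b :* v)))) ≈-refl
                                              V (sign n) (sign j) (q^ square ∣ j - n ∣) (qBinomial (2 * n) j)) ⟩
  ∑ (λ j → sign n ⊛ (sign j ⊛ (q^ square ∣ j - n ∣ ⊛ gaussRemainder n j))) (suc (2 * n)) ∎
  where
  O = oddRising 0 n
  V = evenPochhammer n
  n+n≡2n : n + n ≡ 2 * n
  n+n≡2n = cong (λ x → n + x) (sym (ℕ.+-identityʳ n))

evenPochhammer-split : ∀ {j n} → j ≤ n → evenPochhammer n ≈ evenPochhammer j ⊛ evenRising (suc j) (n ∸ j)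
evenPochhammer-split {j} {n} j≤n =
  ≈-trans (≈-reflexive (cong evenPochhammer (sym (ℕ.m+[n∸m]≡n j≤n)))) (evenRising-+ 1 j (n ∸ j))

gaussRemainder-≈[<]-𝟙 : ∀ N n j → N ≤ n → N ≤ j → N + j ≤ 2 * n → gaussRemainder n j ≈[< suc N ] 𝟙
gaussRemainder-≈[<]-𝟙 N n j N≤n N≤j N+j≤2n with ℕ.≤-total j n
... | inj₁ j≤n = ≈[<]-trans (≈⇒≈[<] (begin
  qBinomial (2 * n) j ⊛ evenPochhammer n
    ≈⟨ ⊛-congˡ (qBinomial (2 * n) j) (evenPochhammer-split j≤n) ⟩
  qBinomial (2 * n) j ⊛ (evenPochhammer j ⊛ evenRising (suc j) (n ∸ j))
    ≈⟨ ≈-sym (⊛-assoc (qBinomial (2 * n) j) (evenPochhammer j) _) ⟩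
  qBinomial (2 * n) j ⊛ evenPochhammer j ⊛ evenRising (suc j) (n ∸ j)
    ≈⟨ ⊛-congʳ (evenRising (suc j) (n ∸ j)) (qBinomial-⊛-evenPochhammer (2 * n) j j≤2n) ⟩
  evenRising (suc (2 * n ∸ j)) j ⊛ evenRising (suc j) (n ∸ j) ∎))
  (≈[<]-trans (⊛-cong-≈[<] (evenRising-≈[<]-𝟙 _ j (s≤s N≤2n∸j)) (evenRising-≈[<]-𝟙 _ (n ∸ j) (s≤s N≤j)))
              (≈⇒≈[<] (⊛-identityˡ 𝟙)))
  where
  j≤2n   = ℕ.m+n≤o⇒n≤o N N+j≤2n
  N≤2n∸j = ℕ.m+n≤o⇒m≤o∸n N N+j≤2n
... | inj₂ n≤j = ≈[<]-trans (≈[<]-sym (⊛-≈[<]-𝟙 (gaussRemainder n j) (evenRising-≈[<]-𝟙 _ (j ∸ n) (s≤s N≤n))))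
  (≈[<]-trans (≈⇒≈[<] (begin
    qBinomial (2 * n) j ⊛ evenPochhammer n ⊛ evenRising (suc n) (j ∸ n)
      ≈⟨ ⊛-assoc (qBinomial (2 * n) j) (evenPochhammer n) _ ⟩
    qBinomial (2 * n) j ⊛ (evenPochhammer n ⊛ evenRising (suc n) (j ∸ n))
      ≈⟨ ⊛-congˡ (qBinomial (2 * n) j) (≈-sym (evenPochhammer-split n≤j)) ⟩
    qBinomial (2 * n) j ⊛ evenPochhammer j
      ≈⟨ qBinomial-⊛-evenPochhammer (2 * n) j j≤2n ⟩
    evenRising (suc (2 * n ∸ j)) j ∎))
  (evenRising-≈[<]-𝟙 _ j (s≤s N≤2n∸j)))
  where
  j≤2n   = ℕ.m+n≤o⇒n≤o N N+j≤2n
  N≤2n∸j = ℕ.m+n≤o⇒m≤o∸n N N+j≤2n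

gaussFactor-≈[<]-𝟙 : ∀ d → gaussFactor d ≈[< d ] 𝟙
gaussFactor-≈[<]-𝟙 d = ∏-≈[<]-𝟙 d _ (colours 1 2 d) (λ _ _ → 1-q^-≈[<]-𝟙 d)

gaussProduct-stable : ∀ {N M} → N ≤ M → gaussProduct M ≈[< suc N ] gaussProduct N
gaussProduct-stable {N} {M} N≤M =
  ≈[<]-trans (≈⇒≈[<] (≈-trans (≈-reflexive (cong gaussProduct (sym (ℕ.m+[n∸m]≡n N≤M))))
                               (∏-+ (λ i → gaussFactor (suc i)) N (M ∸ N))))
             (⊛-≈[<]-𝟙 (gaussProduct N)
                (∏-≈[<]-𝟙 (suc N) _ (M ∸ N) (λ i _ →
                   ≈[<]-weaken (s≤s (ℕ.m≤m+n N i)) (gaussFactor-≈[<]-𝟙 (suc (N + i))))))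

q^-⊛-coeff-vanishes : ∀ s X e → s ≢ e → (s ≤ e → X ≈[< suc e ] 𝟙) → (q^ s ⊛ X) e ≡ + 0
q^-⊛-coeff-vanishes s X e s≢e X≈𝟙 with s ℕ.≤? e
... | no s≰e = q^⊛-< s X (ℕ.≰⇒> s≰e)
... | yes s≤e with ℕ.m≤n⇒∃[o]m+o≡n s≤e
...   | zero  , s+0≡e   = contradiction (trans (sym (ℕ.+-identityʳ s)) s+0≡e) s≢e
...   | suc o , s+1+o≡e =
  trans (cong (q^ s ⊛ X) (sym s+1+o≡e))
        (trans (q^⊛-+ s X (suc o)) (X≈𝟙 s≤e (suc o) (s≤s (ℕ.m+n≤o⇒n≤o s (ℕ.≤-reflexive s+1+o≡e)))))

sign-⊛-coeff-vanishes : ∀ k f e → f e ≡ + 0 → (sign k ⊛ f) e ≡ + 0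
sign-⊛-coeff-vanishes zero    f e fe≡0 = trans (⊛-identityˡ f e) fe≡0
sign-⊛-coeff-vanishes (suc k) f e fe≡0 =
  trans (solve 2 (λ s x → (:- s) :* x := :- (s :* x)) ≈-refl (sign k) f e)
        (cong ℤ.-_ (sign-⊛-coeff-vanishes k f e fe≡0))

near-middle : ∀ N j → ∣ j - 2 * N ∣ ≤ N → N ≤ j × N + j ≤ 2 * (2 * N)
near-middle N j close = N≤j , N+j≤4N
  where
  N≤j : N ≤ j
  N≤j = ℕ.+-cancelʳ-≤ N N j (ℕ.≤-trans (ℕ.≤-reflexive (lemma₁ N)) (ℕ.≤-trans (ℕ.m≤n+∣n-m∣ (2 * N) j) (ℕ.+-monoʳ-≤ j close)))
    where
    lemma₁ : ∀ x → x + x ≡ 2 * x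
    lemma₁ = ℕ-solve-∀
  N+j≤4N : N + j ≤ 2 * (2 * N)
  N+j≤4N = ℕ.≤-trans (ℕ.+-monoʳ-≤ N (ℕ.≤-trans (ℕ.m≤n+∣m-n∣ j (2 * N)) (ℕ.+-monoʳ-≤ (2 * N) close)))
                     (ℕ.≤-reflexive (lemma₂ N))
    where
    lemma₂ : ∀ x → x + (2 * x + x) ≡ 2 * (2 * x)
    lemma₂ = ℕ-solve-∀

n≤n*n : ∀ n → n ≤ n * n
n≤n*n zero    = z≤n
n≤n*n (suc n) = ℕ.m≤m*n (suc n) (suc n)

-- With n = 2N every j with (j − n)² ≤ N is close enough to n for its remainder to be ≡ 1 below
-- degree N + 1, so the j-th term contributes to the coefficient of qᵉ only if e = (j − n)².
gaussProduct-coeff-nonsquare : ∀ N e → e ≤ N → (∀ x → x * x ≢ e) → gaussProduct N e ≡ + 0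
gaussProduct-coeff-nonsquare N e e≤N nonsquare =
  trans (sym (gaussProduct-stable N≤M e (s≤s e≤N)))
        (trans (gaussProduct-expansion n e) (∑ℤ-zero (suc M) _ (λ j _ → term j)))
  where
  n = 2 * N
  M = 2 * n
  N≤M : N ≤ M
  N≤M = ℕ.≤-trans (ℕ.m≤n*m N 2) (ℕ.m≤n*m (2 * N) 2)
  term : ∀ j → (sign n ⊛ (sign j ⊛ (q^ square ∣ j - n ∣ ⊛ gaussRemainder n j))) e ≡ + 0
  term j = sign-⊛-coeff-vanishes n _ e (sign-⊛-coeff-vanishes j _ e
             (q^-⊛-coeff-vanishes (square ∣ j - n ∣) (gaussRemainder n j) e (nonsquare ∣ j - n ∣) truncation))
    where
    truncation : square ∣ j - n ∣ ≤ e → gaussRemainder n j ≈[< suc e ] 𝟙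
    truncation s≤e with near-middle N j (ℕ.≤-trans (n≤n*n ∣ j - n ∣) (ℕ.≤-trans s≤e e≤N))
    ... | N≤j , N+j≤2n = ≈[<]-weaken (s≤s e≤N) (gaussRemainder-≈[<]-𝟙 N n j (ℕ.m≤n*m N 2) N≤j N+j≤2n)

-- The generating function of a_{r,s}

-- dilate⊛ e d X = (∑ₜ e t q^(d t)) ⊛ X, written with the same finite sum as the recursion defining P.
dilateTerm : (ℕ → ℤ) → ℕ → Series → ℕ → ℕ → ℤ
dilateTerm e d X n t = if t * d ≤ᵇ n then e t ℤ.* X (n ∸ t * d) else + 0

dilate⊛ : (ℕ → ℤ) → ℕ → Series → Series
dilate⊛ e d X n = ∑ℤ (dilateTerm e d X n) (suc n)

dilateTerm-vanishes : ∀ e d X {n} t → n < t * d → dilateTerm e d X n t ≡ + 0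
dilateTerm-vanishes e d X {n} t n<td with t * d ≤ᵇ n in td≤ᵇn
... | false = refl
... | true  = contradiction (ℕ.≤ᵇ⇒≤ (t * d) n (subst T (sym td≤ᵇn) tt)) (ℕ.<⇒≱ n<td)

≤ᵇ-cancelˡ-+ : ∀ d x y → (d + x ≤ᵇ d + y) ≡ (x ≤ᵇ y)
≤ᵇ-cancelˡ-+ zero    x       y = refl
≤ᵇ-cancelˡ-+ (suc d) x       y = trans (suc-≤ᵇ-suc (d + x) (d + y)) (≤ᵇ-cancelˡ-+ d x y)
  where
  suc-≤ᵇ-suc : ∀ x y → (suc x ≤ᵇ suc y) ≡ (x ≤ᵇ y)
  suc-≤ᵇ-suc zero    y = refl
  suc-≤ᵇ-suc (suc x) y = refl

dilate⊛-low : ∀ e d X {n} → n < d → dilate⊛ e d X n ≡ (e 0 · X) n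
dilate⊛-low e d X {n} n<d =
  trans (+ℤ-congˡ (e 0 ℤ.* X n)
          (∑ℤ-zero n _ (λ t _ → dilateTerm-vanishes e d X (suc t) (ℕ.<-≤-trans n<d (ℕ.m≤m+n d (t * d))))))
        (ℤ.+-identityʳ (e 0 ℤ.* X n))

dilate⊛-high : ∀ e d′ X n →
  dilate⊛ e (suc d′) X (suc d′ + n) ≡ (e 0 · X) (suc d′ + n) ℤ.+ dilate⊛ (e ∘ suc) (suc d′) X n
dilate⊛-high e d′ X n =
  +ℤ-congˡ (e 0 ℤ.* X (d + n))
    (trans (∑ℤ-cong (d + n) (λ t _ → shifted t))
    (trans (cong (∑ℤ (dilateTerm (e ∘ suc) d X n)) (cong suc (ℕ.+-comm d′ n)))
    (trans (∑ℤ-+-length (suc n) d′ (dilateTerm (e ∘ suc) d X n))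
    (trans (+ℤ-congˡ (dilate⊛ (e ∘ suc) d X n) (∑ℤ-zero d′ _ (λ t _ → beyond (suc n + t) (ℕ.m≤m+n (suc n) t))))
           (ℤ.+-identityʳ _)))))
  where
  d = suc d′
  beyond : ∀ t → n < t → dilateTerm (e ∘ suc) d X n t ≡ + 0
  beyond t n<t = dilateTerm-vanishes (e ∘ suc) d X t (ℕ.<-≤-trans n<t (ℕ.m≤m*n t d))
  shifted : ∀ t → dilateTerm e d X (d + n) (suc t) ≡ dilateTerm (e ∘ suc) d X n t
  shifted t = cong₂ (λ b m → if b then e (suc t) ℤ.* X m else + 0)
                    (≤ᵇ-cancelˡ-+ d (t * d) n) (ℕ.[m+n]∸[m+o]≡n∸o d n (t * d))

dilate⊛-unfold : ∀ e d′ X → dilate⊛ e (suc d′) X ≈ e 0 · X ⊕ shift (suc d′) (dilate⊛ (e ∘ suc) (suc d′) X)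
dilate⊛-unfold e d′ X n with n ℕ.<? suc d′
... | yes n<d = trans (dilate⊛-low e (suc d′) X n<d)
                      (sym (trans (+ℤ-congˡ ((e 0 · X) n) (shift-< (suc d′) _ n<d)) (ℤ.+-identityʳ _)))
... | no n≮d with ℕ.m≤n⇒∃[o]m+o≡n (ℕ.≮⇒≥ n≮d)
...   | n′ , refl = trans (dilate⊛-high e d′ X n′) (+ℤ-congˡ ((e 0 · X) n) (sym (shift-+ (suc d′) _ n′)))

shift-recursion-unique : ∀ d′ X (F G : (ℕ → ℤ) → Series) →
  (∀ e → F e ≈ e 0 · X ⊕ shift (suc d′) (F (e ∘ suc))) →
  (∀ e → G e ≈ e 0 · X ⊕ shift (suc d′) (G (e ∘ suc))) →
  ∀ e → F e ≈ G e
shift-recursion-unique d′ X F G F-rec G-rec e n = agree (suc n) e n ℕ.≤-refl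
  where
  agree : ∀ k e n → n < k → F e n ≡ G e n
  agree (suc k) e n n<k =
    trans (F-rec e n) (trans (+ℤ-congˡ ((e 0 · X) n) (shifted n n<k)) (sym (G-rec e n)))
    where
    shifted : ∀ m → m < suc k → shift (suc d′) (F (e ∘ suc)) m ≡ shift (suc d′) (G (e ∘ suc)) m
    shifted m m<k with m ℕ.<? suc d′
    ... | yes m<d = trans (shift-< (suc d′) _ m<d) (sym (shift-< (suc d′) _ m<d))
    ... | no m≮d with ℕ.m≤n⇒∃[o]m+o≡n (ℕ.≮⇒≥ m≮d)
    ...   | m′ , refl = trans (shift-+ (suc d′) _ m′)
                              (trans (agree k (e ∘ suc) m′ (ℕ.<-≤-trans (s≤s (ℕ.m≤n+m m′ d′)) (ℕ.≤-pred m<k)))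
                                     (sym (shift-+ (suc d′) _ m′)))

dilate⊛≈dilate⊛𝟙⊛ : ∀ e d′ X → dilate⊛ e (suc d′) X ≈ dilate⊛ e (suc d′) 𝟙 ⊛ X
dilate⊛≈dilate⊛𝟙⊛ e d′ X =
  shift-recursion-unique d′ X (λ e → dilate⊛ e d X) (λ e → dilate⊛ e d 𝟙 ⊛ X) (λ e → dilate⊛-unfold e d′ X) rec e
  where
  d = suc d′
  rec : ∀ e → dilate⊛ e d 𝟙 ⊛ X ≈ e 0 · X ⊕ shift d (dilate⊛ (e ∘ suc) d 𝟙 ⊛ X)
  rec e = begin
    dilate⊛ e d 𝟙 ⊛ X
      ≈⟨ ⊛-congʳ X (dilate⊛-unfold e d′ 𝟙) ⟩
    (e 0 · 𝟙 ⊕ shift d (dilate⊛ (e ∘ suc) d 𝟙)) ⊛ X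
      ≈⟨ ⊛-distribʳ (e 0 · 𝟙) (shift d (dilate⊛ (e ∘ suc) d 𝟙)) X ⟩
    (e 0 · 𝟙) ⊛ X ⊕ shift d (dilate⊛ (e ∘ suc) d 𝟙) ⊛ X
      ≈⟨ ⊕-cong (≈-trans (·-⊛ (e 0) 𝟙 X) (·-cong (e 0) (⊛-identityˡ X))) (shift-⊛ d _ X) ⟩
    e 0 · X ⊕ shift d (dilate⊛ (e ∘ suc) d 𝟙 ⊛ X) ∎

dilate⊛-cong : ∀ {e e′} d X → (∀ t → e t ≡ e′ t) → dilate⊛ e d X ≈ dilate⊛ e′ d X
dilate⊛-cong d X e≡e′ n = ∑ℤ-cong (suc n) (λ t _ → cong (λ c → if t * d ≤ᵇ n then c ℤ.* X (n ∸ t * d) else + 0) (e≡e′ t))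

dilate⊛-+ : ∀ e e′ d X → dilate⊛ (λ t → e t ℤ.+ e′ t) d X ≈ dilate⊛ e d X ⊕ dilate⊛ e′ d X
dilate⊛-+ e e′ d X n =
  trans (∑ℤ-cong (suc n) (λ t _ → term (t * d ≤ᵇ n) (e t) (e′ t) (X (n ∸ t * d))))
        (∑ℤ-+ (suc n) (dilateTerm e d X n) (dilateTerm e′ d X n))
  where
  term : ∀ b x y z → (if b then (x ℤ.+ y) ℤ.* z else + 0) ≡ (if b then x ℤ.* z else + 0) ℤ.+ (if b then y ℤ.* z else + 0)
  term true  x y z = ℤ.*-distribʳ-+ z x y
  term false x y z = refl

dilate⊛-zero : ∀ d X → dilate⊛ (λ _ → + 0) d X ≈ 𝟘
dilate⊛-zero d X n = ∑ℤ-zero (suc n) _ (λ t _ → term (t * d ≤ᵇ n) (X (n ∸ t * d)))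
  where
  term : ∀ b z → (if b then + 0 ℤ.* z else + 0) ≡ + 0
  term true  z = ℤ.*-zeroˡ z
  term false z = refl

multichoose-pascal : ∀ c t → multichoose (suc c) (suc t) ≡ multichoose (suc c) t + multichoose c (suc t)
multichoose-pascal c t =
  trans (cong (_choose suc t) (ℕ.+-suc c t))
        (trans (sym (nCk+nC[k+1]≡[n+1]C[k+1] (c + t) t))
               (cong (λ n → (c + t) choose t + n choose suc t) (cong (_∸ 1) (sym (ℕ.+-suc c t)))))

-- E c d = (1 − q^d)^(−c)
E : ℕ → ℕ → Series
E c d = dilate⊛ (λ t → + multichoose c t) d 𝟙

E-unfold : ∀ c d′ → E c (suc d′) ≈ 𝟙 ⊕ q^ (suc d′) ⊛ dilate⊛ (λ t → + multichoose c (suc t)) (suc d′) 𝟙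
E-unfold c d′ =
  ≈-trans (dilate⊛-unfold (λ t → + multichoose c t) d′ 𝟙)
          (⊕-cong (λ n → ℤ.*-identityˡ (𝟙 n)) (shift≈q^⊛ (suc d′) _))

E-zero : ∀ d′ → E 0 (suc d′) ≈ 𝟙
E-zero d′ = begin
  E 0 (suc d′)
    ≈⟨ E-unfold 0 d′ ⟩
  𝟙 ⊕ q^ (suc d′) ⊛ dilate⊛ (λ t → + multichoose 0 (suc t)) (suc d′) 𝟙
    ≈⟨ ⊕-cong {𝟙} ≈-refl (⊛-congˡ (q^ (suc d′))
         (≈-trans (dilate⊛-cong (suc d′) 𝟙 (λ t → cong +_ (k>n⇒nCk≡0 (ℕ.n<1+n t)))) (dilate⊛-zero (suc d′) 𝟙))) ⟩
  𝟙 ⊕ q^ (suc d′) ⊛ 𝟘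
    ≈⟨ ≈-trans (⊕-cong {𝟙} ≈-refl (⊛-zeroʳ (q^ (suc d′)))) (⊕-identityʳ 𝟙) ⟩
  𝟙 ∎

1-q^-⊛-E-suc : ∀ c d′ → 1-q^ (suc d′) ⊛ E (suc c) (suc d′) ≈ E c (suc d′)
1-q^-⊛-E-suc c d′ = begin
  (𝟙 ⊕ ⊝ Q) ⊛ E′
    ≈⟨ solve 2 (λ q e → (con (+ 1) :- q) :* e := e :- q :* e) ≈-refl Q E′ ⟩
  E′ ⊕ ⊝ (Q ⊛ E′)
    ≈⟨ ⊕-cong E′-rec (≈-refl {⊝ (Q ⊛ E′)}) ⟩
  (𝟙 ⊕ Q ⊛ (E′ ⊕ R)) ⊕ ⊝ (Q ⊛ E′)
    ≈⟨ solve 3 (λ q e r → (con (+ 1) :+ q :* (e :+ r)) :- q :* e := con (+ 1) :+ q :* r) ≈-refl Q E′ R ⟩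
  𝟙 ⊕ Q ⊛ R
    ≈⟨ ≈-sym (E-unfold c d′) ⟩
  E c d ∎
  where
  d  = suc d′
  Q  = q^ d
  E′ = E (suc c) d
  R  = dilate⊛ (λ t → + multichoose c (suc t)) d 𝟙
  E′-rec : E′ ≈ 𝟙 ⊕ Q ⊛ (E′ ⊕ R)
  E′-rec = ≈-trans (E-unfold (suc c) d′) (⊕-cong {𝟙} ≈-refl (⊛-congˡ Q
             (≈-trans (dilate⊛-cong d 𝟙 (λ t → trans (cong +_ (multichoose-pascal c t)) (ℤ.pos-+ (multichoose (suc c) t) (multichoose c (suc t)))))
                      (dilate⊛-+ (λ t → + multichoose (suc c) t) (λ t → + multichoose c (suc t)) d 𝟙))))

E-suc : ∀ c d′ → E (suc c) (suc d′) ≈ E 1 (suc d′) ⊛ E c (suc d′)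
E-suc c d′ = begin
  E (suc c) d                              ≈⟨ ≈-sym (⊛-identityˡ _) ⟩
  𝟙 ⊛ E (suc c) d                          ≈⟨ ⊛-congʳ (E (suc c) d) (≈-sym inverse) ⟩
  (E 1 d ⊛ 1-q^ d) ⊛ E (suc c) d           ≈⟨ ⊛-assoc (E 1 d) (1-q^ d) (E (suc c) d) ⟩
  E 1 d ⊛ (1-q^ d ⊛ E (suc c) d)           ≈⟨ ⊛-congˡ (E 1 d) (1-q^-⊛-E-suc c d′) ⟩
  E 1 d ⊛ E c d                            ∎
  where
  d = suc d′
  inverse : E 1 d ⊛ 1-q^ d ≈ 𝟙
  inverse = ≈-trans (⊛-comm (E 1 d) (1-q^ d)) (≈-trans (1-q^-⊛-E-suc 0 d′) (E-zero d′))

E-+ : ∀ a b d′ → E (a + b) (suc d′) ≈ E a (suc d′) ⊛ E b (suc d′)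
E-+ zero    b d′ = ≈-sym (≈-trans (⊛-congʳ (E b (suc d′)) (E-zero d′)) (⊛-identityˡ _))
E-+ (suc a) b d′ = begin
  E (suc (a + b)) d          ≈⟨ E-suc (a + b) d′ ⟩
  E 1 d ⊛ E (a + b) d        ≈⟨ ⊛-congˡ (E 1 d) (E-+ a b d′) ⟩
  E 1 d ⊛ (E a d ⊛ E b d)    ≈⟨ ≈-sym (⊛-assoc (E 1 d) (E a d) (E b d)) ⟩
  E 1 d ⊛ E a d ⊛ E b d      ≈⟨ ⊛-congʳ (E b d) (≈-sym (E-suc a d′)) ⟩
  E (suc a) d ⊛ E b d        ∎
  where d = suc d′

E-* : ∀ p w d′ → E (p * w) (suc d′) ≈ pow (E w (suc d′)) p
E-* zero    w d′ = E-zero d′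
E-* (suc p) w d′ = ≈-trans (E-+ w (p * w) d′) (⊛-congˡ (E w (suc d′)) (E-* p w d′))

E-lower : ∀ t c d′ → E c (suc d′) ≈ pow (1-q^ (suc d′)) t ⊛ E (t + c) (suc d′)
E-lower zero    c d′ = ≈-sym (⊛-identityˡ (E c (suc d′)))
E-lower (suc t) c d′ = begin
  E c d                                       ≈⟨ E-lower t c d′ ⟩
  pow (1-q^ d) t ⊛ E (t + c) d                ≈⟨ ⊛-congˡ (pow (1-q^ d) t) (≈-sym (1-q^-⊛-E-suc (t + c) d′)) ⟩
  pow (1-q^ d) t ⊛ (1-q^ d ⊛ E (suc t + c) d) ≈⟨ solve 3 (λ x y z → x :* (y :* z) := (y :* x) :* z) ≈-refl
                                                      (pow (1-q^ d) t) (1-q^ d) (E (suc t + c) d) ⟩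
  pow (1-q^ d) (suc t) ⊛ E (suc t + c) d      ∎
  where d = suc d′

partitionSeries : ℕ → ℕ → ℕ → Series
partitionSeries r s m n = + P r s n m

+-sum-applyUpTo : ∀ (f g : ℕ → ℕ) k → + sum (map f (applyUpTo g k)) ≡ ∑ℤ (λ t → + f (g t)) k
+-sum-applyUpTo f g zero    = refl
+-sum-applyUpTo f g (suc k) = trans (ℤ.pos-+ (f (g 0)) _) (+ℤ-congˡ (+ f (g 0)) (+-sum-applyUpTo f (g ∘ suc) k))

+-if : ∀ b x y → + (if b then x * y else 0) ≡ (if b then + x ℤ.* + y else + 0)
+-if true  x y = ℤ.pos-* x y
+-if false x y = refl

partCount : ℕ → ℕ → ℕ → ℕ → ℕ → ℕ
partCount r s m n t = if t * suc m ≤ᵇ n then multichoose (colours r s (suc m)) t * P r s (n ∸ t * suc m) m else 0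

P-suc : ∀ r s m n → P r s n (suc m) ≡ sum (map (partCount r s m n) (upTo (suc n)))
P-suc r s m zero    = refl
P-suc r s m (suc n) = refl

partitionSeries-suc : ∀ r s m →
  partitionSeries r s (suc m) ≈ dilate⊛ (λ t → + multichoose (colours r s (suc m)) t) (suc m) (partitionSeries r s m)
partitionSeries-suc r s m n =
  trans (cong +_ (P-suc r s m n))
        (trans (+-sum-applyUpTo (partCount r s m n) id (suc n))
               (∑ℤ-cong (suc n) (λ t _ → +-if (t * suc m ≤ᵇ n) (multichoose (colours r s (suc m)) t) (P r s (n ∸ t * suc m) m))))

partitionSeries-∏ : ∀ r s m → partitionSeries r s m ≈ ∏ (λ i → E (colours r s (suc i)) (suc i)) m
partitionSeries-∏ r s zero    zero    = refl
partitionSeries-∏ r s zero    (suc n) = refl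
partitionSeries-∏ r s (suc m) = begin
  partitionSeries r s (suc m)
    ≈⟨ partitionSeries-suc r s m ⟩
  dilate⊛ (λ t → + multichoose c t) (suc m) (partitionSeries r s m)
    ≈⟨ dilate⊛≈dilate⊛𝟙⊛ (λ t → + multichoose c t) m (partitionSeries r s m) ⟩
  E c (suc m) ⊛ partitionSeries r s m
    ≈⟨ ⊛-congˡ (E c (suc m)) (partitionSeries-∏ r s m) ⟩
  E c (suc m) ⊛ ∏ factor m
    ≈⟨ ⊛-comm (E c (suc m)) (∏ factor m) ⟩
  ∏ factor m ⊛ E c (suc m)
    ≈⟨ ≈-sym (∏-suc factor m) ⟩
  ∏ factor (suc m) ∎
  where
  c = colours r s (suc m)
  factor : ℕ → Series
  factor i = E (colours r s (suc i)) (suc i)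

-- Frobenius congruence

θ : Series → Series
θ f n = + n ℤ.* f n

θ-⊛ : ∀ f g → θ (f ⊛ g) ≈ θ f ⊛ g ⊕ f ⊛ θ g
θ-⊛ f g n =
  trans (cong (+ n ℤ.*_) (⊛-coeff f g n))
  (trans (∑ℤ-*ˡ (suc n) (+ n) (λ i → f i ℤ.* g (n ∸ i)))
  (trans (∑ℤ-cong (suc n) (λ i i≤n → split i (ℕ.≤-pred i≤n)))
  (trans (∑ℤ-+ (suc n) (λ i → θ f i ℤ.* g (n ∸ i)) (λ i → f i ℤ.* θ g (n ∸ i)))
         (sym (cong₂ ℤ._+_ (⊛-coeff (θ f) g n) (⊛-coeff f (θ g) n))))))
  where
  leibniz : ∀ a b x y → (a ℤ.+ b) ℤ.* (x ℤ.* y) ≡ a ℤ.* x ℤ.* y ℤ.+ x ℤ.* (b ℤ.* y)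
  leibniz = solve-∀
  split : ∀ i → i ≤ n → + n ℤ.* (f i ℤ.* g (n ∸ i)) ≡ θ f i ℤ.* g (n ∸ i) ℤ.+ f i ℤ.* θ g (n ∸ i)
  split i i≤n = trans (cong (ℤ._* (f i ℤ.* g (n ∸ i))) (trans (cong +_ (sym (ℕ.m+[n∸m]≡n i≤n))) (ℤ.pos-+ i (n ∸ i))))
                      (leibniz (+ i) (+ (n ∸ i)) (f i) (g (n ∸ i)))

θ-𝟙 : θ 𝟙 ≈ 𝟘
θ-𝟙 zero    = refl
θ-𝟙 (suc n) = ℤ.*-zeroʳ (+ suc n)

constant-suc : ∀ {k} → 𝟙 ⊕ constant (+ suc k) ≈ constant (+ suc (suc k))
constant-suc zero    = refl
constant-suc (suc n) = refl

θ-pow : ∀ f k → θ (pow f (suc k)) ≈ constant (+ suc k) ⊛ (pow f k ⊛ θ f)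
θ-pow f zero = begin
  θ (f ⊛ 𝟙)                 ≈⟨ θ-⊛ f 𝟙 ⟩
  θ f ⊛ 𝟙 ⊕ f ⊛ θ 𝟙         ≈⟨ ⊕-cong {θ f ⊛ 𝟙} ≈-refl (≈-trans (⊛-congˡ f θ-𝟙) (⊛-zeroʳ f)) ⟩
  θ f ⊛ 𝟙 ⊕ 𝟘               ≈⟨ ⊕-identityʳ (θ f ⊛ 𝟙) ⟩
  θ f ⊛ 𝟙                   ≈⟨ solve 1 (λ t → t :* con (+ 1) := con (+ 1) :* (con (+ 1) :* t)) ≈-refl (θ f) ⟩
  𝟙 ⊛ (𝟙 ⊛ θ f)             ∎
θ-pow f (suc k) = begin
  θ (f ⊛ pow f (suc k))
    ≈⟨ θ-⊛ f (pow f (suc k)) ⟩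
  θ f ⊛ pow f (suc k) ⊕ f ⊛ θ (pow f (suc k))
    ≈⟨ ⊕-cong {θ f ⊛ pow f (suc k)} ≈-refl (⊛-congˡ f (θ-pow f k)) ⟩
  θ f ⊛ (f ⊛ pow f k) ⊕ f ⊛ (constant (+ suc k) ⊛ (pow f k ⊛ θ f))
    ≈⟨ solve 4 (λ t x y c → t :* (x :* y) :+ x :* (c :* (y :* t)) := (con (+ 1) :+ c) :* ((x :* y) :* t))
             ≈-refl (θ f) f (pow f k) (constant (+ suc k)) ⟩
  (𝟙 ⊕ constant (+ suc k)) ⊛ (pow f (suc k) ⊛ θ f)
    ≈⟨ ⊛-congʳ (pow f (suc k) ⊛ θ f) constant-suc ⟩
  constant (+ suc (suc k)) ⊛ (pow f (suc k) ⊛ θ f) ∎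

constant-⊛ : ∀ c f → constant c ⊛ f ≈ c · f
constant-⊛ c f zero    = refl
constant-⊛ c f (suc n) = trans (+ℤ-congˡ (c ℤ.* f (suc n)) (⊛-zeroˡ f n)) (ℤ.+-identityʳ _)

prime∣pow-coeff : ∀ p f m → Prime (suc p) → ¬ (suc p ∣ m) → + suc p ℤ∣ pow f (suc p) m
prime∣pow-coeff p f m p-prime p∤m with euclidsLemma m ℤ.∣ F m ∣ p-prime (divides ℤ.∣ Y m ∣ m*∣Fm∣≡∣Ym∣*p)
  where
  F = pow f (suc p)
  Y = pow f p ⊛ θ f
  m*Fm≡p*Ym : + m ℤ.* F m ≡ + suc p ℤ.* Y m
  m*Fm≡p*Ym = trans (θ-pow f p m) (constant-⊛ (+ suc p) Y m)
  m*∣Fm∣≡∣Ym∣*p : m * ℤ.∣ F m ∣ ≡ ℤ.∣ Y m ∣ * suc p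
  m*∣Fm∣≡∣Ym∣*p = trans (sym (ℤ.abs-* (+ m) (F m)))
                        (trans (cong ℤ.∣_∣ m*Fm≡p*Ym) (trans (ℤ.abs-* (+ suc p) (Y m)) (ℕ.*-comm (suc p) ℤ.∣ Y m ∣)))
... | inj₁ p∣m   = contradiction p∣m p∤m
... | inj₂ p∣∣Fm∣ = ∣ᵤ⇒∣ p∣∣Fm∣

partitionSeries-decomposition : ∀ {p r s u v} → suc r ≡ p * u → suc (suc s) ≡ p * v → ∀ m →
  partitionSeries r s m ≈ gaussProduct m ⊛ pow (∏ (λ i → E (colours u v (suc i)) (suc i)) m) p
partitionSeries-decomposition {p} {r} {s} {u} {v} r+1≡pu s+2≡pv m = begin
  partitionSeries r s m
    ≈⟨ partitionSeries-∏ r s m ⟩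
  ∏ (λ i → E (colours r s (suc i)) (suc i)) m
    ≈⟨ ∏-cong m (λ i → factor (suc i ℕ.% 2 ≤ᵇ 0) i) ⟩
  ∏ (λ i → gaussFactor (suc i) ⊛ pow (G i) p) m
    ≈⟨ ∏-⊛ (λ i → gaussFactor (suc i)) (λ i → pow (G i) p) m ⟩
  gaussProduct m ⊛ ∏ (λ i → pow (G i) p) m
    ≈⟨ ⊛-congˡ (gaussProduct m) (∏-pow G p m) ⟩
  gaussProduct m ⊛ pow (∏ G m) p ∎
  where
  G : ℕ → Series
  G i = E (colours u v (suc i)) (suc i)
  factor : ∀ b d′ → E (if b then r else s) (suc d′)
                      ≈ pow (1-q^ (suc d′)) (if b then 1 else 2) ⊛ pow (E (if b then u else v) (suc d′)) p
  factor true  d′ = ≈-trans (E-lower 1 r d′) (⊛-congˡ (pow (1-q^ (suc d′)) 1)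
                      (≈-trans (≈-reflexive (cong (λ c → E c (suc d′)) r+1≡pu)) (E-* p u d′)))
  factor false d′ = ≈-trans (E-lower 2 s d′) (⊛-congˡ (pow (1-q^ (suc d′)) 2)
                      (≈-trans (≈-reflexive (cong (λ c → E c (suc d′)) s+2≡pv)) (E-* p v d′)))

∑ℤ-divisible : ∀ {d} m h → (∀ i → i < m → d ℤ∣ h i) → d ℤ∣ ∑ℤ h m
∑ℤ-divisible zero    h _   = ∣ᵤ⇒∣ (_ ∣0)
∑ℤ-divisible (suc m) h d∣h = ∣m∣n⇒∣m+n (d∣h 0 (s≤s z≤n)) (∑ℤ-divisible m (h ∘ suc) (λ i i<m → d∣h (suc i) (s≤s i<m)))

⊛-coeff-divisible : ∀ {d} f g n → (∀ i → i ≤ n → d ℤ∣ f i ℤ.* g (n ∸ i)) → d ℤ∣ (f ⊛ g) n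
⊛-coeff-divisible f g n d∣term =
  subst (_ ℤ∣_) (sym (⊛-coeff f g n)) (∑ℤ-divisible (suc n) _ (λ i i≤n → d∣term i (ℕ.≤-pred i≤n)))

quotient-≤ : ∀ {p r} n q → r < p → q * p ≤ p * n + r → q ≤ n
quotient-≤ {p} {r} n q r<p qp≤pn+r =
  ℕ.≤-pred (ℕ.*-cancelʳ-< p q (suc n) (ℕ.≤-<-trans qp≤pn+r (ℕ.<-≤-trans (ℕ.+-monoʳ-< (p * n) r<p) (ℕ.≤-reflexive (lemma p n)))))
  where
  lemma : ∀ x y → x * y + x ≡ suc y * x
  lemma = ℕ-solve-∀

QNR⇒∸-multiple-nonsquare : ∀ {p r} → QNR p r → r < p → ∀ n q → q * p ≤ p * n + r → ∀ x → x * x ≢ (p * n + r) ∸ q * p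
QNR⇒∸-multiple-nonsquare {p} {r} qnr r<p n q qp≤pn+r x with ℕ.m≤n⇒∃[o]m+o≡n (quotient-≤ n q r<p qp≤pn+r)
... | u , refl = λ x²≡ → qnr x u (trans x²≡ (trans (cong (_∸ q * p) (lemma p q u r)) (ℕ.m+n∸m≡n (q * p) (u * p + r))))
  where
  lemma : ∀ x y z w → x * (y + z) + w ≡ y * x + (z * x + w)
  lemma = ℕ-solve-∀

pow-⊛-gaussProduct-coeff-divisible : ∀ p′ {r} G n → Prime (suc p′) → r < suc p′ → QNR (suc p′) r →
  + suc p′ ℤ∣ (pow G (suc p′) ⊛ gaussProduct (suc p′ * n + r)) (suc p′ * n + r)
pow-⊛-gaussProduct-coeff-divisible p′ {r} G n p-prime r<p qnr = ⊛-coeff-divisible (pow G p) (gaussProduct N) N term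
  where
  p = suc p′
  N = p * n + r
  term : ∀ t → t ≤ N → + p ℤ∣ pow G p t ℤ.* gaussProduct N (N ∸ t)
  term t t≤N with p ∣? t
  ... | no p∤t = ∣m⇒∣m*n (gaussProduct N (N ∸ t)) (prime∣pow-coeff p′ G t p-prime p∤t)
  ... | yes (divides q refl) =
    ∣n⇒∣m*n (pow G p t)
      (subst (+ p ℤ∣_) (sym (gaussProduct-coeff-nonsquare N (N ∸ t) (ℕ.m∸n≤m N t)
                                (QNR⇒∸-multiple-nonsquare qnr r<p n q t≤N)))
             (∣ᵤ⇒∣ (p ∣0)))

suc-*-+-pred : ∀ p′ x → suc (suc p′ * x + p′) ≡ suc p′ * suc x
suc-*-+-pred = ℕ-solve-∀

-- From 5 ≤ p only p ≥ 2 is used.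
theorem1p15 : ∀ (p r : ℕ) → Prime p → 5 ≤ p → 1 ≤ r → r ≤ p ∸ 1 → QNR p r →
    ∀ (n k j : ℕ) → j ≤ k →
      p ∣ a (p * (k ∸ j) + (p ∸ 1)) (p * k + (p ∸ 2)) (p * n + r)
theorem1p15 zero             r _       ()
theorem1p15 (suc zero)       r _       (s≤s ())
theorem1p15 p@(suc (suc p″)) r p-prime _ _ r≤p∸1 qnr n k j _ =
  ∣⇒∣ᵤ (subst (+ p ℤ∣_) (sym coefficient)
               (pow-⊛-gaussProduct-coeff-divisible (suc p″) G n p-prime (s≤s r≤p∸1) qnr))
  where
  N = p * n + r
  G = ∏ (λ i → E (colours (suc (k ∸ j)) (suc k) (suc i)) (suc i)) N
  coefficient : + a (p * (k ∸ j) + (p ∸ 1)) (p * k + (p ∸ 2)) N ≡ (pow G p ⊛ gaussProduct N) N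
  coefficient = trans (partitionSeries-decomposition {p} (suc-*-+-pred (suc p″) (k ∸ j))
                                                         (trans (cong suc (sym (ℕ.+-suc (p * k) p″)))
                                                                (suc-*-+-pred (suc p″) k)) N N)
                      (⊛-comm (gaussProduct N) (pow G p) N)
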